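{- Let $\sigma\in\{213,312\}$ and let $j^{\operatorname{des}}_{m,k}(\sigma)$ be the number of $\sigma$-avoiding Jacobi permutations $\pi\in\mathfrak{S}_m$ with $\operatorname{des}(\pi)=k$. Then \[ j^{\operatorname{des}}_{2n,k}(\sigma)=\frac{1}{n}\binom{n}{k-n}\binom{2n}{k+1}\quad\text{for all }n\geq1,\ k\geq0, \] \[ j^{\operatorname{des}}_{2n+1,k}(\sigma)=\frac{1}{n+1}\binom{n+1}{k-n}\binom{2n}{k}\quad\text{for all }n,k\geq0. \]
   Context: A permutation of a finite set $S$ of positive integers is a word in which each element of $S$ appears exactly once; $\mathfrak{S}_m$ is the set of permutations of $\{1,\dots,m\}$. For a permutation $\pi$ and a letter $x$ of $\pi$, $\rho_\pi(x)$ is the maximal consecutive subword of $\pi$ consisting of the letters immediately to the right of $x$ that are all larger than $x$. $\pi$ is Jacobi if $|\rho_\pi(x)|$ is even for all letters $x$. A permutation $\pi$ avoids a pattern $\sigma$ if no subword of $\pi$ has standardization (relative order) $\sigma$. A descent of $\pi\in\mathfrak{S}_m$ is an index $i\in[m-1]$ with $\pi_i>\pi_{i+1}$; $\operatorname{des}(\pi)$ is the number of descents. Binomial coefficients $\binom{a}{b}$ are $0$ when $b<0$ or $b>a$. -}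

module Defs where

open import Data.Nat using (ℕ; zero; suc; _+_; _*_; _<_; _≤_; _<ᵇ_; _<?_; _∸_)
open import Data.Bool using (Bool; true; false; if_then_else_)
open import Data.List using (List; []; _∷_; length; lookup; upTo; map; takeWhile)
open import Data.List.Relation.Binary.Permutation.Propositional using (_↭_)
open import Data.List.Relation.Binary.Sublist.Propositional using (_⊆_)
open import Data.List.Membership.Propositional using (_∈_)
open import Data.List.Relation.Unary.Unique.Propositional using (Unique)
open import Data.List.Relation.Unary.All using (All)
open import Data.Fin using (Fin; cast)
open import Data.Product using (Σ; _×_)
open import Relation.Binary.PropositionalEquality using (_≡_)
open import Relation.Nullary using (¬_)
open import Function.Bundles using (_⇔_)
open import Data.Unit using (⊤)
open import Data.Nat.Combinatorics using (_C_)

Even : ℕ → Set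
Even n = Σ ℕ λ h → n ≡ h + h

oneTo : ℕ → List ℕ
oneTo m = map suc (upTo m)

IsPerm : ℕ → List ℕ → Set
IsPerm m π = π ↭ oneTo m

des : List ℕ → ℕ
des [] = 0
des (x ∷ []) = 0
des (x ∷ y ∷ xs) = (if y <ᵇ x then 1 else 0) + des (y ∷ xs)

-- |ρ_π(x)| for the letter x followed by the suffix `rest`:
-- length of the maximal run of letters right after x that are all larger than x
ρlen : ℕ → List ℕ → ℕ
ρlen x rest = length (takeWhile (λ y → x <? y) rest)

Jacobi : List ℕ → Set
Jacobi [] = ⊤
Jacobi (x ∷ rest) = Even (ρlen x rest) × Jacobi rest

OrderIso : List ℕ → List ℕ → Set
OrderIso w σ = Σ (length w ≡ length σ) λ eq →
  (i j : Fin (length w)) →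
    (lookup w i < lookup w j) ⇔
    (lookup σ (cast eq i) < lookup σ (cast eq j))

Contains : List ℕ → List ℕ → Set
Contains π σ = Σ (List ℕ) λ w → (w ⊆ π) × OrderIso w σ

Avoids : List ℕ → List ℕ → Set
Avoids π σ = ¬ Contains π σ

JDes : List ℕ → ℕ → ℕ → List ℕ → Set
JDes σ m k π = IsPerm m π × Avoids π σ × Jacobi π × des π ≡ k

Enumerates : (List ℕ → Set) → List (List ℕ) → Set
Enumerates P L = Unique L × ((π : List ℕ) → (π ∈ L) ⇔ P π)

-- binomZ a k n = binom(a, k - n), where k - n is an integer; equals 0 when k < n
-- (and, as usual, when k - n > a)
binomZ : ℕ → ℕ → ℕ → ℕ
binomZ a k n = if k <ᵇ n then 0 else a C (k ∸ n)

{-# OPTIONS --safe #-}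
-- Deleting the letter 1 from a σ-avoiding Jacobi permutation π = α 1 β leaves two blocks of
-- consecutive values, α above β for σ = 213 and below it for σ = 312.  Their standardizations l, r
-- are again σ-avoiding Jacobi permutations, |r| = |ρ(1)| is even, and des π = des l + [l ≠ ∅] + des r;
-- conversely every such pair recombines.  Applied twice, a nonempty word of even length is
-- combine (combine b a₁) a₂ with b, a₁, a₂ of even length, so the words are enumerated by forests
-- of even words sitting in slots, a left slot weighing des + [≠ ∅] and a right slot des.  The
-- number of forests satisfies a Pascal-type recurrence in the numbers r, s of right and left slots,
-- and so does the Lagrange-inversion expression X − 2Y − Z in products of two binomial
-- coefficients, with the same boundary values.  The absorption identity n X = (2n + r) Y + (n + s) Z
-- turns this into n · #forests = r Y + s Z: the claimed formula for one right slot (even length)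
-- and for a left and a right slot (odd length).
module Submission where

open import Defs
open import Data.Nat using (ℕ; suc; _*_)
open import Data.Nat.Combinatorics using (_C_)
open import Data.List using (List; _∷_; []; length)
open import Data.Sum using (_⊎_)
open import Data.Product using (_×_; Σ)
open import Relation.Binary.PropositionalEquality using (_≡_)

open import Data.Nat
open import Data.Nat.Properties
open import Data.Nat.Combinatorics using (nCk+nC[k+1]≡[n+1]C[k+1]; nC1≡n; k>n⇒nCk≡0; nCk≡nC[n∸k])
open import Data.Nat.Tactic.RingSolver using (solve-∀)
open import Data.Bool using (true; false; if_then_else_)
open import Data.Fin using (Fin; zero; suc)
open import Data.Fin.Properties using (cast-is-id)
open import Data.List using (_++_; [_]; map; filter; applyUpTo; lookup)
open import Data.List.Properties
  using (length-map; length-++; filter-++; filter-all; filter-none; map-upTo; map-∘; map-id-local;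
         ++-identityʳ; ++-assoc; ++-conicalʳ; ∷-injective; map-injective)
open import Data.List.Relation.Unary.All as All using (All; []; _∷_)
import Data.List.Relation.Unary.All.Properties as All
open import Data.List.Relation.Unary.AllPairs as AllPairs using ([]; _∷_)
open import Data.List.Relation.Unary.Any using (here; there)
open import Data.List.Membership.Propositional using (_∈_)
open import Data.List.Membership.Propositional.Properties using (∈-∃++; ∈-++⁻; ∈-++⁺ˡ; ∈-++⁺ʳ; ∈-map⁺; ∈-map⁻)
open import Data.List.Relation.Binary.Permutation.Propositional
  using (_↭_; ↭-refl; ↭-sym; ↭-trans; ↭-reflexive; ↭-prep; ↭⇒↭ₛ)
open import Data.List.Relation.Binary.Permutation.Propositional.Properties
  using (All-resp-↭; ∈-resp-↭; ↭-length; filter-↭; map⁺; ++⁺; ++-comm; drop-∷)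
  renaming (shift to ↭-shift)
import Data.List.Relation.Binary.Permutation.Setoid.Properties as PermutationSetoid
open import Data.List.Relation.Binary.Sublist.Propositional using (_⊆_; []; _∷_; _∷ʳ_; ⊆-refl; ⊆-trans; from∈)
import Data.List.Relation.Binary.Sublist.Propositional.Properties as Sublist
open import Data.List.Relation.Unary.Unique.Propositional using (Unique)
import Data.List.Relation.Unary.Unique.Propositional.Properties as Unique
open import Data.List.Relation.Binary.Disjoint.Propositional using (Disjoint)
open import Data.List.Extrema.Nat using (max; xs≤max; max≤v⁺; max<v⁺)
open import Data.Vec using (Vec; []; _∷_; head)
import Data.Vec.Properties as Vec
open import Data.Vec.Relation.Unary.All as VecAll using ([]; _∷_)
open import Data.Product using (_,_; proj₁; proj₂)
open import Data.Sum using (inj₁; inj₂)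
open import Function using (_∘_)
open import Function.Bundles using (_⇔_; mk⇔; Equivalence)
open import Relation.Nullary using (¬_; contradiction)
open import Relation.Nullary.Decidable using (dec-true; dec-false)
open import Relation.Unary using (Pred; Decidable)
open import Relation.Binary.PropositionalEquality
  using (_≢_; refl; sym; trans; cong; cong₂; subst; subst₂; ≢-sym; setoid; module ≡-Reasoning)
open import Algebra.Properties.CommutativeSemigroup *-commutativeSemigroup using (x∙yz≈y∙xz)

-- Binomial coefficients with an integer lower index

binomZ-pascal : ∀ t a b → binomZ (suc t) a b ≡ binomZ t a b + binomZ t a (suc b)
binomZ-pascal t zero    zero    = refl
binomZ-pascal t (suc a) zero    = trans (sym (nCk+nC[k+1]≡[n+1]C[k+1] t a)) (+-comm (t C a) (t C suc a))
binomZ-pascal t zero    (suc b) = refl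
binomZ-pascal t (suc a) (suc b) = binomZ-pascal t a b

binomZ-< : ∀ t {a b} → a < b → binomZ t a b ≡ 0
binomZ-< t {zero}  {suc b} _         = refl
binomZ-< t {suc a} {suc b} (s≤s a<b) = binomZ-< t a<b

binomZ-≥ : ∀ t {a b} → b ≤ a → binomZ t a b ≡ t C (a ∸ b)
binomZ-≥ t {a}     {zero}  _         = refl
binomZ-≥ t {suc a} {suc b} (s≤s b≤a) = binomZ-≥ t b≤a

binomZ-symmetry : ∀ t j → binomZ t t j ≡ t C j
binomZ-symmetry t j with ≤-<-connex j t
... | inj₁ j≤t = trans (binomZ-≥ t j≤t) (sym (nCk≡nC[n∸k] j≤t))
... | inj₂ t<j = trans (binomZ-< t t<j) (sym (k>n⇒nCk≡0 t<j))

C-absorption : ∀ n k → suc k * (suc n C suc k) ≡ suc n * (n C k)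
C-absorption zero    zero    = refl
C-absorption zero    (suc k) = *-zeroʳ (suc (suc k))
C-absorption (suc n) zero    = trans (+-identityʳ _) (trans (nC1≡n (suc (suc n))) (sym (*-identityʳ (suc (suc n)))))
C-absorption (suc n) (suc k) = begin
  suc (suc k) * (suc (suc n) C suc (suc k))
    ≡⟨ cong (suc (suc k) *_) (sym (nCk+nC[k+1]≡[n+1]C[k+1] (suc n) (suc k))) ⟩
  suc (suc k) * (suc n C suc k + suc n C suc (suc k))
    ≡⟨ expand (suc n C suc k) (suc n C suc (suc k)) k ⟩
  suc k * (suc n C suc k) + suc n C suc k + suc (suc k) * (suc n C suc (suc k))
    ≡⟨ cong₂ (λ a b → a + suc n C suc k + b) (C-absorption n k) (C-absorption n (suc k)) ⟩
  suc n * (n C k) + suc n C suc k + suc n * (n C suc k)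
    ≡⟨ collect (n C k) (n C suc k) (suc n C suc k) n ⟩
  suc n * (n C k + n C suc k) + suc n C suc k
    ≡⟨ cong (λ c → suc n * c + suc n C suc k) (nCk+nC[k+1]≡[n+1]C[k+1] n k) ⟩
  suc n * (suc n C suc k) + suc n C suc k
    ≡⟨ +-comm (suc n * (suc n C suc k)) _ ⟩
  suc (suc n) * (suc n C suc k) ∎
  where
  open ≡-Reasoning
  expand : ∀ a b k → suc (suc k) * (a + b) ≡ suc k * a + a + suc (suc k) * b
  expand = solve-∀
  collect : ∀ a b c n → suc n * a + c + suc n * b ≡ suc n * (a + b) + c
  collect = solve-∀

binomZ-absorption : ∀ t a b → t * binomZ (t ∸ 1) a (suc b) ≡ (a ∸ b) * binomZ t a b
binomZ-absorption t       zero    zero    = *-zeroʳ t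
binomZ-absorption t       zero    (suc b) = *-zeroʳ t
binomZ-absorption zero    (suc a) zero    = sym (*-zeroʳ (suc a))
binomZ-absorption (suc t) (suc a) zero    = sym (C-absorption t a)
binomZ-absorption t       (suc a) (suc b) = binomZ-absorption t a b

-- Unlike 2 * n, double (suc n) reduces to suc (suc (double n)), as the recurrences below need.
double : ℕ → ℕ
double zero    = zero
double (suc n) = suc (suc (double n))

double≡+ : ∀ n → double n ≡ n + n
double≡+ zero    = refl
double≡+ (suc n) = cong suc (trans (cong suc (double≡+ n)) (sym (+-suc n n)))

double≡2* : ∀ n → double n ≡ 2 * n
double≡2* n = trans (double≡+ n) (cong (n +_) (sym (+-identityʳ n)))

-- The number of forests in closed form

data Slot : Set where
  left right : Slot

#left #right : List Slot → ℕ
#left []            = 0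
#left (left ∷ sl)   = suc (#left sl)
#left (right ∷ sl)  = #left sl
#right []           = 0
#right (left ∷ sl)  = #right sl
#right (right ∷ sl) = suc (#right sl)

nodeSlots : List Slot → List Slot
nodeSlots sl = left ∷ right ∷ right ∷ sl

-- The number of forests of total length 2n and weight k over the slots sl (length-forests).
forestCount : ℕ → List Slot → ℕ → ℕ
nodeCount  : ℕ → Slot → List Slot → ℕ → ℕ

forestCount n       (s ∷ sl) k       = forestCount n sl k + nodeCount n s sl k
forestCount zero    []       zero    = 1
forestCount zero    []       (suc k) = 0
forestCount (suc n) []       k       = 0

nodeCount (suc n) right sl (suc k)       = forestCount n (nodeSlots sl) k
nodeCount (suc n) left  sl (suc (suc k)) = forestCount n (nodeSlots sl) k
nodeCount _       _     _  _             = 0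

U₀ U₁ V₀ V₁ : ℕ → ℕ → ℕ → ℕ
U₀ n s k = binomZ (n + s) k n
U₁ n s k = binomZ (n + s ∸ 1) k (suc n)
V₀ n r k = binomZ (double n + r) (double n) k
V₁ n r k = binomZ (double n + r ∸ 1) (double n) (suc k)

-- With E the bivariate generating function of a right slot, 1 + t (E − 1) is that of a left slot
-- and E = 1 + x t (1 + t (E − 1)) E²; Lagrange inversion gives forestCount = X − 2Y − Z.
X Y Z : ℕ → List Slot → ℕ → ℕ
X n sl k = U₀ n (#left sl) k * V₀ n (#right sl) k
Y n sl k = U₀ n (#left sl) k * V₁ n (#right sl) k
Z n sl k = U₁ n (#left sl) k * V₀ n (#right sl) k

record UFactor (U : ℕ → ℕ → ℕ → ℕ) : Set where
  field
    shift  : ∀ n s k → U (suc n) s (suc k) ≡ U n (suc s) k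
    pascal : ∀ n s k → U (suc n) (suc s) (2 + k) ≡ U (suc n) s (2 + k) + U n (suc s) k

record VFactor (V : ℕ → ℕ → ℕ → ℕ) : Set where
  field
    shift  : ∀ n r k → V (suc n) r (2 + k) ≡ V n (2 + r) k
    pascal : ∀ n r k → V (suc n) (suc r) (suc k) ≡ V (suc n) r (suc k) + V n (2 + r) k

record SlotRecurrence (F : ℕ → List Slot → ℕ → ℕ) : Set where
  field
    right-step : ∀ n sl k → F (suc n) (right ∷ sl) (suc k) ≡ F (suc n) sl (suc k) + F n (nodeSlots sl) k
    left-step  : ∀ n sl k → F (suc n) (left ∷ sl) (2 + k) ≡ F (suc n) sl (2 + k) + F n (nodeSlots sl) k

product-recurrence : ∀ {U V} → UFactor U → VFactor V →
                     SlotRecurrence (λ n sl k → U n (#left sl) k * V n (#right sl) k)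
SlotRecurrence.right-step (product-recurrence {U} {V} u v) n sl k =
  trans (cong (U (suc n) (#left sl) (suc k) *_) (VFactor.pascal v n (#right sl) k))
        (trans (*-distribˡ-+ (U (suc n) (#left sl) (suc k)) _ _)
               (cong₂ _+_ refl (cong (_* V n (2 + #right sl) k) (UFactor.shift u n (#left sl) k))))
SlotRecurrence.left-step (product-recurrence {U} {V} u v) n sl k =
  trans (cong (_* V (suc n) (#right sl) (2 + k)) (UFactor.pascal u n (#left sl) k))
        (trans (*-distribʳ-+ (V (suc n) (#right sl) (2 + k)) (U (suc n) (#left sl) (2 + k)) _)
               (cong₂ _+_ refl (cong (U n (suc (#left sl)) k *_) (VFactor.shift v n (#right sl) k))))

U₀-factor : UFactor U₀
UFactor.shift  U₀-factor n s k rewrite +-suc n s = refl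
UFactor.pascal U₀-factor n s k rewrite +-suc n s = binomZ-pascal (suc (n + s)) (suc k) n

U₁-factor : UFactor U₁
UFactor.shift  U₁-factor n s k rewrite +-suc n s = refl
UFactor.pascal U₁-factor n s k rewrite +-suc n s = binomZ-pascal (n + s) k n

V₀-factor : VFactor V₀
VFactor.shift  V₀-factor n r k rewrite +-suc (double n) (suc r) | +-suc (double n) r = refl
VFactor.pascal V₀-factor n r k rewrite +-suc (double n) (suc r) | +-suc (double n) r =
  binomZ-pascal (suc (suc (double n + r))) (suc (double n)) k

V₁-factor : VFactor V₁
VFactor.shift  V₁-factor n r k rewrite +-suc (double n) (suc r) | +-suc (double n) r = refl
VFactor.pascal V₁-factor n r k rewrite +-suc (double n) (suc r) | +-suc (double n) r =
  binomZ-pascal (suc (double n + r)) (double n) k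

X-recurrence : SlotRecurrence X
X-recurrence = product-recurrence U₀-factor V₀-factor

Y-recurrence : SlotRecurrence Y
Y-recurrence = product-recurrence U₀-factor V₁-factor

Z-recurrence : SlotRecurrence Z
Z-recurrence = product-recurrence U₁-factor V₀-factor

forestCount-below : ∀ {n k} sl → k < n → forestCount n sl k ≡ 0
nodeCount-below  : ∀ {n k} s sl → k < n → nodeCount n s sl k ≡ 0

forestCount-below {suc n} []       k<n = refl
forestCount-below {suc n} (s ∷ sl) k<n = cong₂ _+_ (forestCount-below sl k<n) (nodeCount-below s sl k<n)

nodeCount-below {suc n} {zero}        right sl _   = refl
nodeCount-below {suc n} {suc k}       right sl (s≤s k<n) = forestCount-below (nodeSlots sl) k<n
nodeCount-below {suc n} {zero}        left  sl _   = refl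
nodeCount-below {suc n} {suc zero}    left  sl _   = refl
nodeCount-below {suc n} {suc (suc k)} left  sl (s≤s k<n) =
  forestCount-below (nodeSlots sl) (<-trans (n<1+n k) k<n)

forestCount-zero : ∀ sl k → forestCount zero sl k ≡ forestCount zero [] k
forestCount-zero []       k = refl
forestCount-zero (s ∷ sl) k = trans (+-identityʳ _) (forestCount-zero sl k)

ClosedForm : ℕ → List Slot → ℕ → Set
ClosedForm n sl k = forestCount n sl k + 2 * Y n sl k + Z n sl k ≡ X n sl k

closedForm-below : ∀ {n k} sl → k < n → ClosedForm n sl k
closedForm-below {n} {k} sl k<n
  rewrite forestCount-below sl k<n | binomZ-< (n + #left sl) k<n | binomZ-< (n + #left sl ∸ 1) (m<n⇒m<1+n k<n) = refl

closedForm-zero : ∀ sl k → ClosedForm zero sl k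
closedForm-zero sl zero    rewrite forestCount-zero sl zero = refl
closedForm-zero sl (suc k)
  rewrite forestCount-zero sl (suc k)
        | *-zeroʳ (U₀ 0 (#left sl) (suc k)) | *-zeroʳ (U₁ 0 (#left sl) (suc k)) = refl

∸-window : ∀ {n k} → n ≤ k → k ≤ double n → (double n ∸ k) + (k ∸ n) ≡ n
∸-window {n} {k} n≤k k≤2n = begin
  (double n ∸ k) + (k ∸ n)        ≡⟨ cong₂ (λ d e → (d ∸ e) + (e ∸ n)) (double≡+ n) (sym k≡n+i) ⟩
  (n + n ∸ (n + i)) + (n + i ∸ n) ≡⟨ cong₂ _+_ ([m+n]∸[m+o]≡n∸o n n i) (m+n∸m≡n n i) ⟩
  (n ∸ i) + i                     ≡⟨ m∸n+n≡m i≤n ⟩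
  n                               ∎
  where
  open ≡-Reasoning
  i : ℕ
  i = k ∸ n
  k≡n+i : n + i ≡ k
  k≡n+i = m+[n∸m]≡n n≤k
  i≤n : i ≤ n
  i≤n = +-cancelˡ-≤ n i n (subst₂ _≤_ (sym k≡n+i) (double≡+ n) k≤2n)

X-vanishes-or-window : ∀ n sl k → X n sl k ≡ 0 ⊎ (double n ∸ k) + (k ∸ n) ≡ n
X-vanishes-or-window n sl k with <-≤-connex k n | <-≤-connex (double n) k
... | inj₁ k<n | _          = inj₁ (cong (_* V₀ n (#right sl) k) (binomZ-< (n + #left sl) k<n))
... | inj₂ n≤k | inj₁ 2n<k  = inj₁ (trans (cong (U₀ n (#left sl) k *_) (binomZ-< (double n + #right sl) 2n<k))
                                          (*-zeroʳ (U₀ n (#left sl) k)))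
... | inj₂ n≤k | inj₂ k≤2n  = inj₂ (∸-window n≤k k≤2n)

XYZ-identity : ∀ n sl k → n * X n sl k ≡ (double n + #right sl) * Y n sl k + (n + #left sl) * Z n sl k
XYZ-identity n sl k = begin
  n * x                                   ≡⟨ scale (X-vanishes-or-window n sl k) ⟩
  ((double n ∸ k) + (k ∸ n)) * x           ≡⟨ *-distribʳ-+ x (double n ∸ k) (k ∸ n) ⟩
  (double n ∸ k) * (u₀ * v₀) + (k ∸ n) * (u₀ * v₀)
    ≡⟨ cong₂ _+_ (x∙yz≈y∙xz (double n ∸ k) u₀ v₀) (sym (*-assoc (k ∸ n) u₀ v₀)) ⟩
  u₀ * ((double n ∸ k) * v₀) + ((k ∸ n) * u₀) * v₀
    ≡⟨ cong₂ _+_ (cong (u₀ *_) (sym (binomZ-absorption (double n + r) (double n) k)))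
                 (cong (_* v₀) (sym (binomZ-absorption (n + s) k n))) ⟩
  u₀ * ((double n + r) * v₁) + ((n + s) * u₁) * v₀
    ≡⟨ cong₂ _+_ (x∙yz≈y∙xz u₀ (double n + r) v₁) (*-assoc (n + s) u₁ v₀) ⟩
  (double n + r) * (u₀ * v₁) + (n + s) * (u₁ * v₀) ∎
  where
  open ≡-Reasoning
  r s u₀ u₁ v₀ v₁ x : ℕ
  r = #right sl
  s = #left sl
  u₀ = U₀ n s k
  u₁ = U₁ n s k
  v₀ = V₀ n r k
  v₁ = V₁ n r k
  x = X n sl k
  scale : x ≡ 0 ⊎ (double n ∸ k) + (k ∸ n) ≡ n → n * x ≡ ((double n ∸ k) + (k ∸ n)) * x
  scale (inj₁ x≡0) rewrite x≡0 = trans (*-zeroʳ n) (sym (*-zeroʳ ((double n ∸ k) + (k ∸ n))))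
  scale (inj₂ eq)  = cong (_* x) (sym eq)

closedForm-no-slots : ∀ n k → ClosedForm (suc n) [] k
closedForm-no-slots n k = *-cancelˡ-≡ (2 * y + z) x (suc n) (begin
  suc n * (2 * y + z)                              ≡⟨ regroup (suc n) y z ⟩
  (suc n + suc n + 0) * y + (suc n + 0) * z        ≡⟨ cong (λ d → (d + 0) * y + (suc n + 0) * z) (sym (double≡+ (suc n))) ⟩
  (double (suc n) + 0) * y + (suc n + 0) * z       ≡⟨ sym (XYZ-identity (suc n) [] k) ⟩
  suc n * x                                        ∎)
  where
  open ≡-Reasoning
  x y z : ℕ
  x = X (suc n) [] k
  y = Y (suc n) [] k
  z = Z (suc n) [] k
  regroup : ∀ m y z → m * (2 * y + z) ≡ (m + m + 0) * y + (m + 0) * z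
  regroup = solve-∀

forestCount-recurrence : SlotRecurrence forestCount
forestCount-recurrence = record { right-step = λ _ _ _ → refl ; left-step = λ _ _ _ → refl }

closedForm-step : ∀ {n sl k n₁ sl₁ k₁ n₂ sl₂ k₂} →
                  (∀ {F} → SlotRecurrence F → F n sl k ≡ F n₁ sl₁ k₁ + F n₂ sl₂ k₂) →
                  ClosedForm n₁ sl₁ k₁ → ClosedForm n₂ sl₂ k₂ → ClosedForm n sl k
closedForm-step {n} {sl} {k} {n₁} {sl₁} {k₁} {n₂} {sl₂} {k₂} split cf₁ cf₂
  rewrite split forestCount-recurrence | split Y-recurrence | split Z-recurrence =
  trans (regroup (forestCount n₁ sl₁ k₁) (forestCount n₂ sl₂ k₂) (Y n₁ sl₁ k₁) (Y n₂ sl₂ k₂)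
                 (Z n₁ sl₁ k₁) (Z n₂ sl₂ k₂))
        (trans (cong₂ _+_ cf₁ cf₂) (sym (split X-recurrence)))
  where
  regroup : ∀ c₁ c₂ y₁ y₂ z₁ z₂ →
            (c₁ + c₂) + 2 * (y₁ + y₂) + (z₁ + z₂) ≡ (c₁ + 2 * y₁ + z₁) + (c₂ + 2 * y₂ + z₂)
  regroup = solve-∀

closedForm : ∀ n sl k → ClosedForm n sl k
closedForm zero          sl           k             = closedForm-zero sl k
closedForm (suc n)       []           k             = closedForm-no-slots n k
closedForm (suc n)       (right ∷ sl) zero          = closedForm-below (right ∷ sl) (s≤s z≤n)
closedForm (suc n)       (right ∷ sl) (suc k)       =
  closedForm-step (λ rec → SlotRecurrence.right-step rec n sl k)
    (closedForm (suc n) sl (suc k)) (closedForm n (nodeSlots sl) k)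
closedForm (suc n)       (left ∷ sl)  zero          = closedForm-below (left ∷ sl) (s≤s z≤n)
closedForm (suc zero)    (left ∷ sl)  (suc zero)    =
  -- a nonempty word in a left slot weighs at least 2, and X, Y, Z at n = k = 1 ignore #left sl
  subst (λ c → c + 2 * Y 1 sl 1 + Z 1 sl 1 ≡ X 1 sl 1) (sym (+-identityʳ _)) (closedForm 1 sl 1)
closedForm (suc (suc n)) (left ∷ sl)  (suc zero)    = closedForm-below (left ∷ sl) (s≤s (s≤s z≤n))
closedForm (suc n)       (left ∷ sl)  (suc (suc k)) =
  closedForm-step (λ rec → SlotRecurrence.left-step rec n sl k)
    (closedForm (suc n) sl (2 + k)) (closedForm n (nodeSlots sl) k)

forestCount-identity : ∀ n sl k → n * forestCount n sl k ≡ #right sl * Y n sl k + #left sl * Z n sl k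
forestCount-identity n sl k = +-cancelʳ-≡ (n * (2 * y) + n * z) _ _ (begin
  n * c + (n * (2 * y) + n * z)                 ≡⟨ distribute n c y z ⟩
  n * (c + 2 * y + z)                           ≡⟨ cong (n *_) (closedForm n sl k) ⟩
  n * X n sl k                                  ≡⟨ XYZ-identity n sl k ⟩
  (double n + r) * y + (n + s) * z              ≡⟨ cong (λ d → (d + r) * y + (n + s) * z) (double≡+ n) ⟩
  (n + n + r) * y + (n + s) * z                 ≡⟨ regroup n r s y z ⟩
  r * y + s * z + (n * (2 * y) + n * z)         ∎)
  where
  open ≡-Reasoning
  c r s y z : ℕ
  c = forestCount n sl k
  r = #right sl
  s = #left sl
  y = Y n sl k
  z = Z n sl k
  distribute : ∀ n c y z → n * c + (n * (2 * y) + n * z) ≡ n * (c + 2 * y + z)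
  distribute = solve-∀
  regroup : ∀ n r s y z → (n + n + r) * y + (n + s) * z ≡ r * y + s * z + (n * (2 * y) + n * z)
  regroup = solve-∀

evenCount : ∀ n k → suc n * forestCount (suc n) (right ∷ []) k ≡ binomZ (suc n) k (suc n) * ((2 * suc n) C suc k)
evenCount n k = begin
  suc n * forestCount (suc n) (right ∷ []) k                     ≡⟨ forestCount-identity (suc n) (right ∷ []) k ⟩
  1 * Y (suc n) (right ∷ []) k + 0                               ≡⟨ trans (+-identityʳ _) (*-identityˡ _) ⟩
  binomZ (suc n + 0) k (suc n) * binomZ (double (suc n) + 1 ∸ 1) (double (suc n)) (suc k)
    ≡⟨ cong₂ (λ a t → binomZ a k (suc n) * binomZ t (double (suc n)) (suc k))
             (+-identityʳ (suc n)) (m+n∸n≡m (double (suc n)) 1) ⟩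
  binomZ (suc n) k (suc n) * binomZ (double (suc n)) (double (suc n)) (suc k)
    ≡⟨ cong (binomZ (suc n) k (suc n) *_) (trans (binomZ-symmetry (double (suc n)) (suc k)) (cong (_C suc k) (double≡2* (suc n)))) ⟩
  binomZ (suc n) k (suc n) * ((2 * suc n) C suc k) ∎
  where open ≡-Reasoning

oddCount : ∀ n k → suc n * forestCount n (left ∷ right ∷ []) k ≡ binomZ (suc n) k n * ((2 * n) C k)
oddCount n k = begin
  suc n * c                                        ≡⟨ +-cancelʳ-≡ y _ _ counted ⟩
  U₀ n 1 k * binomZ (double n) (double n) k        ≡⟨ cong₂ _*_ (cong (λ t → binomZ t k n) (+-comm n 1))
                                                                (trans (binomZ-symmetry (double n) k) (cong (_C k) (double≡2* n))) ⟩
  binomZ (suc n) k n * ((2 * n) C k)               ∎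
  where
  open ≡-Reasoning
  c y z t : ℕ
  c = forestCount n (left ∷ right ∷ []) k
  y = Y n (left ∷ right ∷ []) k
  z = Z n (left ∷ right ∷ []) k
  t = U₀ n 1 k * binomZ (double n) (double n) k
  X≡t+y : X n (left ∷ right ∷ []) k ≡ t + y
  X≡t+y = begin
    U₀ n 1 k * binomZ (double n + 1) (double n) k
      ≡⟨ cong (λ m → U₀ n 1 k * binomZ m (double n) k) (+-comm (double n) 1) ⟩
    U₀ n 1 k * binomZ (suc (double n)) (double n) k
      ≡⟨ cong (U₀ n 1 k *_) (binomZ-pascal (double n) (double n) k) ⟩
    U₀ n 1 k * (binomZ (double n) (double n) k + binomZ (double n) (double n) (suc k))
      ≡⟨ *-distribˡ-+ (U₀ n 1 k) _ _ ⟩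
    t + U₀ n 1 k * binomZ (double n) (double n) (suc k)
      ≡⟨ cong (λ m → t + U₀ n 1 k * binomZ m (double n) (suc k)) (sym (m+n∸n≡m (double n) 1)) ⟩
    t + y ∎
  counted : suc n * c + y ≡ t + y
  counted = begin
    suc n * c + y              ≡⟨ cong (λ m → c + m + y) (forestCount-identity n (left ∷ right ∷ []) k) ⟩
    c + (1 * y + 1 * z) + y    ≡⟨ regroup c y z ⟩
    c + 2 * y + z              ≡⟨ closedForm n (left ∷ right ∷ []) k ⟩
    X n (left ∷ right ∷ []) k  ≡⟨ X≡t+y ⟩
    t + y                      ∎
    where
    regroup : ∀ c y z → c + (1 * y + 1 * z) + y ≡ c + 2 * y + z
    regroup = solve-∀

-- Permutations of intervals

range : ℕ → ℕ → List ℕ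
range c zero    = []
range c (suc n) = suc c ∷ range (suc c) n

applyUpTo≡range : ∀ (f : ℕ → ℕ) c n → (∀ i → f i ≡ suc (c + i)) → applyUpTo f n ≡ range c n
applyUpTo≡range f c zero    f≗ = refl
applyUpTo≡range f c (suc n) f≗ =
  cong₂ _∷_ (trans (f≗ 0) (cong suc (+-identityʳ c)))
            (applyUpTo≡range (f ∘ suc) (suc c) n (λ i → trans (f≗ (suc i)) (cong suc (+-suc c i))))

oneTo≡range : ∀ m → oneTo m ≡ range 0 m
oneTo≡range m = trans (map-upTo suc m) (applyUpTo≡range suc 0 m (λ _ → refl))

length-range : ∀ c n → length (range c n) ≡ n
length-range c zero    = refl
length-range c (suc n) = cong suc (length-range (suc c) n)

range-++ : ∀ c a b → range c (a + b) ≡ range c a ++ range (c + a) b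
range-++ c zero    b = cong (λ d → range d b) (sym (+-identityʳ c))
range-++ c (suc a) b = cong (suc c ∷_) (trans (range-++ (suc c) a b) (cong (λ d → range (suc c) a ++ range d b) (sym (+-suc c a))))

map-+-range : ∀ d c n → map (d +_) (range c n) ≡ range (d + c) n
map-+-range d c zero    = refl
map-+-range d c (suc n) = cong₂ _∷_ (+-suc d c) (trans (map-+-range d (suc c) n) (cong (λ e → range e n) (+-suc d c)))

map-∸-range : ∀ d c n → map (_∸ d) (range (d + c) n) ≡ range c n
map-∸-range d c zero    = refl
map-∸-range d c (suc n) = cong₂ _∷_ (trans (cong (_∸ d) (sym (+-suc d c))) (m+n∸m≡n d (suc c)))
                                    (trans (cong (λ e → map (_∸ d) (range e n)) (sym (+-suc d c))) (map-∸-range d (suc c) n))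

range-bounds : ∀ c n → All (λ x → c < x × x ≤ c + n) (range c n)
range-bounds c zero    = []
range-bounds c (suc n) = (≤-refl , subst (suc c ≤_) (sym (+-suc c n)) (s≤s (m≤m+n c n)))
  ∷ All.map (λ {x} (c<x , x≤) → <-trans (n<1+n c) c<x , subst (x ≤_) (sym (+-suc c n)) x≤) (range-bounds (suc c) n)

range-unique : ∀ c n → Unique (range c n)
range-unique c zero    = []
range-unique c (suc n) = All.map (λ (c<x , _) → <⇒≢ c<x) (range-bounds (suc c) n) ∷ range-unique (suc c) n

↭-range-bounds : ∀ {c n w} → w ↭ range c n → All (λ x → c < x × x ≤ c + n) w
↭-range-bounds {c} {n} w↭ = All-resp-↭ (↭-sym w↭) (range-bounds c n)

↭-range-unique : ∀ {c n w} → w ↭ range c n → Unique w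
↭-range-unique {c} {n} w↭ = PermutationSetoid.Unique-resp-↭ (setoid ℕ) (↭⇒↭ₛ (↭-sym w↭)) (range-unique c n)

↭-range-length : ∀ {c n w} → w ↭ range c n → length w ≡ n
↭-range-length {c} {n} w↭ = trans (↭-length w↭) (length-range c n)

map-+-↭-range : ∀ c {n w} → w ↭ range 0 n → map (c +_) w ↭ range c n
map-+-↭-range c {n} w↭ =
  ↭-trans (map⁺ (c +_) w↭) (↭-reflexive (trans (map-+-range c 0 n) (cong (λ d → range d n) (+-identityʳ c))))

Shifted : ℕ → List ℕ → Set
Shifted c w = Σ (List ℕ) λ v → w ≡ map (c +_) v × v ↭ range 0 (length v)

↭-range-unshift : ∀ c {w} → w ↭ range c (length w) → Shifted c w
↭-range-unshift c {w} w↭ =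
  map (_∸ c) w , sym shift-back ,
  ↭-trans (map⁺ (_∸ c) w↭) (↭-reflexive (trans unshift-range (cong (range 0) (sym (length-map (_∸ c) w)))))
  where
  unshift-range : map (_∸ c) (range c (length w)) ≡ range 0 (length w)
  unshift-range = trans (cong (λ d → map (_∸ c) (range d (length w))) (sym (+-identityʳ c))) (map-∸-range c 0 (length w))
  shift-back : map (c +_) (map (_∸ c) w) ≡ w
  shift-back = trans (sym (map-∘ w)) (map-id-local (All.map (λ (c<x , _) → m+[n∸m]≡n (<⇒≤ c<x)) (↭-range-bounds w↭)))

module _ {ℓ} {P : Pred ℕ ℓ} (P? : Decidable P) where

  filter-keeps-prefix : ∀ {xs ys} → All P xs → All (¬_ ∘ P) ys → filter P? (xs ++ ys) ≡ xs
  filter-keeps-prefix {xs} {ys} pxs ¬pys =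
    trans (filter-++ P? xs ys) (trans (cong₂ _++_ (filter-all P? pxs) (filter-none P? ¬pys)) (++-identityʳ xs))

  filter-keeps-suffix : ∀ {xs ys} → All (¬_ ∘ P) xs → All P ys → filter P? (xs ++ ys) ≡ ys
  filter-keeps-suffix {xs} {ys} ¬pxs pys =
    trans (filter-++ P? xs ys) (cong₂ _++_ (filter-none P? ¬pxs) (filter-all P? pys))

↭-range-blocks : ∀ {m} xs ys → xs ++ ys ↭ range 0 m → (∀ {x y} → x ∈ xs → y ∈ ys → x < y) →
                 xs ↭ range 0 (length xs) × ys ↭ range (length xs) (length ys)
↭-range-blocks {m} xs ys π↭ xs<ys =
  subst (λ a → xs ↭ range 0 a) (sym |xs|≡M) lower ,
  subst₂ (λ a b → ys ↭ range a b) (sym |xs|≡M) (sym (↭-range-length upper)) upper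
  where
  M : ℕ
  M = max 0 xs
  xs-bounds : All (λ x → 0 < x × x ≤ m) xs
  xs-bounds = All.++⁻ˡ xs (↭-range-bounds π↭)
  ys-bounds : All (λ x → 0 < x × x ≤ m) ys
  ys-bounds = All.++⁻ʳ xs (↭-range-bounds π↭)
  xs≤M : All (_≤ M) xs
  xs≤M = xs≤max 0 xs
  M<ys : All (M <_) ys
  M<ys = All.tabulate λ y∈ys → max<v⁺ (proj₁ (All.lookup ys-bounds y∈ys)) (All.tabulate λ x∈xs → xs<ys x∈xs y∈ys)
  M≤m : M ≤ m
  M≤m = max≤v⁺ z≤n (All.map proj₂ xs-bounds)
  range-split : range 0 m ≡ range 0 M ++ range M (m ∸ M)
  range-split = trans (cong (range 0) (sym (m+[n∸m]≡n M≤m))) (range-++ 0 M (m ∸ M))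
  lower : xs ↭ range 0 M
  lower = subst₂ _↭_
    (filter-keeps-prefix (_≤? M) xs≤M (All.map <⇒≱ M<ys))
    (trans (cong (filter (_≤? M)) range-split)
           (filter-keeps-prefix (_≤? M) (All.map proj₂ (range-bounds 0 M)) (All.map (<⇒≱ ∘ proj₁) (range-bounds M (m ∸ M)))))
    (filter-↭ (_≤? M) π↭)
  upper : ys ↭ range M (m ∸ M)
  upper = subst₂ _↭_
    (filter-keeps-suffix (M <?_) (All.map ≤⇒≯ xs≤M) M<ys)
    (trans (cong (filter (M <?_)) range-split)
           (filter-keeps-suffix (M <?_) (All.map (≤⇒≯ ∘ proj₂) (range-bounds 0 M)) (All.map proj₁ (range-bounds M (m ∸ M)))))
    (filter-↭ (M <?_) π↭)
  |xs|≡M : length xs ≡ M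
  |xs|≡M = ↭-range-length lower

-- Descents and the Jacobi property around a smallest letter

-- A word in a left slot is followed by a smaller letter, which adds a descent when it is nonempty.
weight : Slot → List ℕ → ℕ
weight left  []      = 0
weight left  (x ∷ w) = suc (des (x ∷ w))
weight right w       = des w

<ᵇ-+ : ∀ c m n → (c + m <ᵇ c + n) ≡ (m <ᵇ n)
<ᵇ-+ zero    m n = refl
<ᵇ-+ (suc c) m n = <ᵇ-+ c m n

des-map-+ : ∀ c w → des (map (c +_) w) ≡ des w
des-map-+ c []          = refl
des-map-+ c (x ∷ [])    = refl
des-map-+ c (x ∷ y ∷ w) = cong₂ _+_ (cong (λ b → if b then 1 else 0) (<ᵇ-+ c y x)) (des-map-+ c (y ∷ w))

weight-map-+ : ∀ s c w → weight s (map (c +_) w) ≡ weight s w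
weight-map-+ left  c []      = refl
weight-map-+ left  c (x ∷ w) = cong suc (des-map-+ c (x ∷ w))
weight-map-+ right c w       = des-map-+ c w

des-++-min : ∀ {y} xs ys → All (y <_) xs → des (xs ++ y ∷ ys) ≡ weight left xs + des (y ∷ ys)
des-++-min             []            ys _ = refl
des-++-min {y}         (x ∷ [])      ys (y<x ∷ _) rewrite dec-true (y <? x) y<x = refl
des-++-min {y}         (x ∷ x′ ∷ xs) ys (_ ∷ y<xs) =
  trans (cong (b +_) (des-++-min (x′ ∷ xs) ys y<xs))
        (trans (+-suc b (des (x′ ∷ xs) + des (y ∷ ys))) (cong suc (sym (+-assoc b (des (x′ ∷ xs)) (des (y ∷ ys))))))
  where
  b : ℕ
  b = if x′ <ᵇ x then 1 else 0

des-∷-min : ∀ {y} ys → All (y <_) ys → des (y ∷ ys) ≡ des ys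
des-∷-min         []       _         = refl
des-∷-min {y}     (z ∷ zs) (y<z ∷ _) rewrite dec-false (z <? y) (<⇒≯ y<z) = refl

ρlen-stop : ∀ {x y} xs ys → ¬ x < y → ρlen x (xs ++ y ∷ ys) ≡ ρlen x xs
ρlen-stop {x} {y} []       ys x≮y rewrite dec-false (x <? y) x≮y = refl
ρlen-stop {x}     (z ∷ xs) ys x≮y with x <ᵇ z
... | true  = cong suc (ρlen-stop xs ys x≮y)
... | false = refl

ρlen-all : ∀ {x} ys → All (x <_) ys → ρlen x ys ≡ length ys
ρlen-all     []       _            = refl
ρlen-all {x} (y ∷ ys) (x<y ∷ x<ys) rewrite dec-true (x <? y) x<y = cong suc (ρlen-all ys x<ys)

ρlen-map-+ : ∀ c x ys → ρlen (c + x) (map (c +_) ys) ≡ ρlen x ys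
ρlen-map-+ c x []       = refl
ρlen-map-+ c x (y ∷ ys) rewrite <ᵇ-+ c x y with x <ᵇ y
... | true  = cong suc (ρlen-map-+ c x ys)
... | false = refl

Jacobi-map-+⁺ : ∀ c w → Jacobi w → Jacobi (map (c +_) w)
Jacobi-map-+⁺ c []      _          = _
Jacobi-map-+⁺ c (x ∷ w) (even , j) = subst Even (sym (ρlen-map-+ c x w)) even , Jacobi-map-+⁺ c w j

Jacobi-map-+⁻ : ∀ c w → Jacobi (map (c +_) w) → Jacobi w
Jacobi-map-+⁻ c []      _          = _
Jacobi-map-+⁻ c (x ∷ w) (even , j) = subst Even (ρlen-map-+ c x w) even , Jacobi-map-+⁻ c w j

Jacobi-++-min⁺ : ∀ {y} xs ys → All (y <_) xs → Jacobi xs → Jacobi (y ∷ ys) → Jacobi (xs ++ y ∷ ys)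
Jacobi-++-min⁺ []       ys _            _          j = j
Jacobi-++-min⁺ (x ∷ xs) ys (y<x ∷ y<xs) (even , j) j′ =
  subst Even (sym (ρlen-stop xs ys (<⇒≯ y<x))) even , Jacobi-++-min⁺ xs ys y<xs j j′

Jacobi-++-min⁻ : ∀ {y} xs ys → All (y <_) xs → Jacobi (xs ++ y ∷ ys) → Jacobi xs × Jacobi (y ∷ ys)
Jacobi-++-min⁻ []       ys _            j          = _ , j
Jacobi-++-min⁻ (x ∷ xs) ys (y<x ∷ y<xs) (even , j) =
  (subst Even (ρlen-stop xs ys (<⇒≯ y<x)) even , proj₁ (Jacobi-++-min⁻ xs ys y<xs j)) , proj₂ (Jacobi-++-min⁻ xs ys y<xs j)

Jacobi-∷-min⁺ : ∀ {y} ys → All (y <_) ys → Even (length ys) → Jacobi ys → Jacobi (y ∷ ys)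
Jacobi-∷-min⁺ ys y<ys even j = subst Even (sym (ρlen-all ys y<ys)) even , j

Jacobi-∷-min⁻ : ∀ {y} ys → All (y <_) ys → Jacobi (y ∷ ys) → Even (length ys) × Jacobi ys
Jacobi-∷-min⁻ ys y<ys (even , j) = subst Even (ρlen-all ys y<ys) even , j

around1 : ℕ → ℕ → List ℕ → List ℕ → List ℕ
around1 c d l r = map (c +_) l ++ 1 ∷ map (d +_) r

Positive : List ℕ → Set
Positive = All (0 <_)

map-+-above : ∀ c {w} → Positive w → All (c <_) (map (c +_) w)
map-+-above c w>0 = All.map⁺ (All.map (m<m+n c) w>0)

shift-above-1 : ∀ c {w} → Positive w → All (1 <_) (map (suc c +_) w)
shift-above-1 c w>0 = All.map (≤-<-trans (s≤s z≤n)) (map-+-above (suc c) w>0)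

length-around1 : ∀ c d l r → length (around1 c d l r) ≡ length l + suc (length r)
length-around1 c d l r = trans (length-++ (map (c +_) l)) (cong₂ (λ a b → a + suc b) (length-map (c +_) l) (length-map (d +_) r))

des-around1 : ∀ c d {l r} → Positive l → Positive r → des (around1 (suc c) (suc d) l r) ≡ weight left l + weight right r
des-around1 c d {l} {r} l>0 r>0 = begin
  des (map (suc c +_) l ++ 1 ∷ map (suc d +_) r)          ≡⟨ des-++-min _ _ (shift-above-1 c l>0) ⟩
  weight left (map (suc c +_) l) + des (1 ∷ map (suc d +_) r) ≡⟨ cong₂ _+_ (weight-map-+ left (suc c) l)
                                                                           (trans (des-∷-min _ (shift-above-1 d r>0)) (des-map-+ (suc d) r)) ⟩
  weight left l + weight right r                            ∎
  where open ≡-Reasoning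

Jacobi-around1⁺ : ∀ c d {l r} → Positive l → Positive r → Jacobi l → Even (length r) → Jacobi r →
                  Jacobi (around1 (suc c) (suc d) l r)
Jacobi-around1⁺ c d {l} {r} l>0 r>0 jl even jr =
  Jacobi-++-min⁺ (map (suc c +_) l) _ (shift-above-1 c l>0) (Jacobi-map-+⁺ (suc c) l jl)
    (Jacobi-∷-min⁺ _ (shift-above-1 d r>0) (subst Even (sym (length-map (suc d +_) r)) even) (Jacobi-map-+⁺ (suc d) r jr))

Jacobi-around1⁻ : ∀ c d {l r} → Positive l → Positive r → Jacobi (around1 (suc c) (suc d) l r) →
                  Jacobi l × Even (length r) × Jacobi r
Jacobi-around1⁻ c d {l} {r} l>0 r>0 j
  with jl , j1r ← Jacobi-++-min⁻ (map (suc c +_) l) _ (shift-above-1 c l>0) j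
  with even , jr ← Jacobi-∷-min⁻ _ (shift-above-1 d r>0) j1r
  = Jacobi-map-+⁻ (suc c) l jl , subst Even (length-map (suc d +_) r) even , Jacobi-map-+⁻ (suc d) r jr

++-1-injective : ∀ xs ys xs′ ys′ → All (1 <_) xs → All (1 <_) xs′ →
                 xs ++ 1 ∷ ys ≡ xs′ ++ 1 ∷ ys′ → xs ≡ xs′ × ys ≡ ys′
++-1-injective []       ys []         ys′ _          _            eq = refl , proj₂ (∷-injective eq)
++-1-injective []       ys (x′ ∷ xs′) ys′ _          (1<x′ ∷ _)   eq = contradiction (proj₁ (∷-injective eq)) (<⇒≢ 1<x′)
++-1-injective (x ∷ xs) ys []         ys′ (1<x ∷ _)  _            eq = contradiction (sym (proj₁ (∷-injective eq))) (<⇒≢ 1<x)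
++-1-injective (x ∷ xs) ys (x′ ∷ xs′) ys′ (_ ∷ 1<xs) (_ ∷ 1<xs′) eq
  with x≡x′ , rest ← ∷-injective eq
  with xs≡xs′ , ys≡ys′ ← ++-1-injective xs ys xs′ ys′ 1<xs 1<xs′ rest
  = cong₂ _∷_ x≡x′ xs≡xs′ , ys≡ys′

map-+-injective : ∀ c {xs ys} → map (c +_) xs ≡ map (c +_) ys → xs ≡ ys
map-+-injective c = map-injective (+-cancelˡ-≡ c _ _)

around1-injective : ∀ c c′ d d′ {l l′ r r′} → Positive l → Positive l′ →
                    around1 (suc c) d l r ≡ around1 (suc c′) d′ l′ r′ →
                    map (suc c +_) l ≡ map (suc c′ +_) l′ × map (d +_) r ≡ map (d′ +_) r′
around1-injective c c′ d d′ l>0 l′>0 = ++-1-injective _ _ _ _ (shift-above-1 c l>0) (shift-above-1 c′ l′>0)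

around1≢[] : ∀ c d l r → around1 c d l r ≢ []
around1≢[] c d l r eq with () ← ++-conicalʳ (map (c +_) l) (1 ∷ map (d +_) r) eq

-- Pattern occurrences

data Pattern : Set where
  p213 p312 : Pattern

letters : Pattern → List ℕ
letters p213 = 2 ∷ 1 ∷ 3 ∷ []
letters p312 = 3 ∷ 1 ∷ 2 ∷ []

Shape : Pattern → ℕ → ℕ → ℕ → Set
Shape p213 x y z = y < x × x < z
Shape p312 x y z = y < z × z < x

Occurs : Pattern → List ℕ → Set
Occurs p π = Σ ℕ λ x → Σ ℕ λ y → Σ ℕ λ z → (x ∷ y ∷ z ∷ []) ⊆ π × Shape p x y z

⇔-both : ∀ {A B : Set} → A → B → A ⇔ B
⇔-both a b = mk⇔ (λ _ → b) (λ _ → a)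

⇔-neither : ∀ {A B : Set} → ¬ A → ¬ B → A ⇔ B
⇔-neither ¬a ¬b = mk⇔ (λ a → contradiction a ¬a) (λ b → contradiction b ¬b)

triple : ℕ → ℕ → ℕ → Fin 3 → ℕ
triple x y z = lookup (x ∷ y ∷ z ∷ [])

SameOrder : (Fin 3 → ℕ) → (Fin 3 → ℕ) → Set
SameOrder u v = ∀ i j → (u i < u j) ⇔ (v i < v j)

SameOrder⇒OrderIso : ∀ {x y z a b c} → SameOrder (triple x y z) (triple a b c) →
                     OrderIso (x ∷ y ∷ z ∷ []) (a ∷ b ∷ c ∷ [])
SameOrder⇒OrderIso {x} {y} {z} {a} {b} {c} same = refl , λ i j →
  subst₂ (λ i′ j′ → (triple x y z i < triple x y z j) ⇔ (triple a b c i′ < triple a b c j′))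
         (sym (cast-is-id refl i)) (sym (cast-is-id refl j)) (same i j)

Contains⇒SameOrder : ∀ {π a b c} → Contains π (a ∷ b ∷ c ∷ []) →
                     Σ ℕ λ x → Σ ℕ λ y → Σ ℕ λ z → (x ∷ y ∷ z ∷ []) ⊆ π × SameOrder (triple x y z) (triple a b c)
Contains⇒SameOrder {a = a} {b} {c} ((x ∷ y ∷ z ∷ []) , xyz⊆π , eq , iso) = x , y , z , xyz⊆π , λ i j →
  subst₂ (λ i′ j′ → (triple x y z i < triple x y z j) ⇔ (triple a b c i′ < triple a b c j′))
         (cast-is-id eq i) (cast-is-id eq j) (iso i j)
Contains⇒SameOrder ([]                  , _ , () , _)
Contains⇒SameOrder ((_ ∷ [])            , _ , () , _)
Contains⇒SameOrder ((_ ∷ _ ∷ [])        , _ , () , _)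
Contains⇒SameOrder ((_ ∷ _ ∷ _ ∷ _ ∷ _) , _ , () , _)

Contains⇒Occurs : ∀ p {π} → Contains π (letters p) → Occurs p π
Contains⇒Occurs p213 c with x , y , z , xyz⊆π , same ← Contains⇒SameOrder c =
  x , y , z , xyz⊆π ,
  Equivalence.from (same (suc zero) zero) (s≤s (s≤s z≤n)) ,
  Equivalence.from (same zero (suc (suc zero))) (s≤s (s≤s (s≤s z≤n)))
Contains⇒Occurs p312 c with x , y , z , xyz⊆π , same ← Contains⇒SameOrder c =
  x , y , z , xyz⊆π ,
  Equivalence.from (same (suc zero) (suc (suc zero))) (s≤s (s≤s z≤n)) ,
  Equivalence.from (same (suc (suc zero)) zero) (s≤s (s≤s (s≤s z≤n)))

Occurs⇒Contains : ∀ p {π} → Occurs p π → Contains π (letters p)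
Occurs⇒Contains p213 (x , y , z , xyz⊆π , y<x , x<z) = (x ∷ y ∷ z ∷ []) , xyz⊆π , SameOrder⇒OrderIso same
  where
  same : SameOrder (triple x y z) (triple 2 1 3)
  same zero                zero                = ⇔-neither (<-irrefl refl) (<-irrefl refl)
  same zero                (suc zero)          = ⇔-neither (<⇒≯ y<x) λ { (s≤s ()) }
  same zero                (suc (suc zero))    = ⇔-both x<z (s≤s (s≤s (s≤s z≤n)))
  same (suc zero)          zero                = ⇔-both y<x (s≤s (s≤s z≤n))
  same (suc zero)          (suc zero)          = ⇔-neither (<-irrefl refl) (<-irrefl refl)
  same (suc zero)          (suc (suc zero))    = ⇔-both (<-trans y<x x<z) (s≤s (s≤s z≤n))
  same (suc (suc zero))    zero                = ⇔-neither (<⇒≯ x<z) λ { (s≤s (s≤s ())) }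
  same (suc (suc zero))    (suc zero)          = ⇔-neither (<⇒≯ (<-trans y<x x<z)) λ { (s≤s ()) }
  same (suc (suc zero))    (suc (suc zero))    = ⇔-neither (<-irrefl refl) (<-irrefl refl)
Occurs⇒Contains p312 (x , y , z , xyz⊆π , y<z , z<x) = (x ∷ y ∷ z ∷ []) , xyz⊆π , SameOrder⇒OrderIso same
  where
  same : SameOrder (triple x y z) (triple 3 1 2)
  same zero                zero                = ⇔-neither (<-irrefl refl) (<-irrefl refl)
  same zero                (suc zero)          = ⇔-neither (<⇒≯ (<-trans y<z z<x)) λ { (s≤s ()) }
  same zero                (suc (suc zero))    = ⇔-neither (<⇒≯ z<x) λ { (s≤s (s≤s ())) }
  same (suc zero)          zero                = ⇔-both (<-trans y<z z<x) (s≤s (s≤s z≤n))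
  same (suc zero)          (suc zero)          = ⇔-neither (<-irrefl refl) (<-irrefl refl)
  same (suc zero)          (suc (suc zero))    = ⇔-both y<z (s≤s (s≤s z≤n))
  same (suc (suc zero))    zero                = ⇔-both z<x (s≤s (s≤s (s≤s z≤n)))
  same (suc (suc zero))    (suc zero)          = ⇔-neither (<⇒≯ y<z) λ { (s≤s ()) }
  same (suc (suc zero))    (suc (suc zero))    = ⇔-neither (<-irrefl refl) (<-irrefl refl)

Shape-+⁺ : ∀ p c {x y z} → Shape p x y z → Shape p (c + x) (c + y) (c + z)
Shape-+⁺ p213 c (y<x , x<z) = +-monoʳ-< c y<x , +-monoʳ-< c x<z
Shape-+⁺ p312 c (y<z , z<x) = +-monoʳ-< c y<z , +-monoʳ-< c z<x

Shape-+⁻ : ∀ p c {x y z} → Shape p (c + x) (c + y) (c + z) → Shape p x y z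
Shape-+⁻ p213 c (y<x , x<z) = +-cancelˡ-< c _ _ y<x , +-cancelˡ-< c _ _ x<z
Shape-+⁻ p312 c (y<z , z<x) = +-cancelˡ-< c _ _ y<z , +-cancelˡ-< c _ _ z<x

⊆-map⁻ : ∀ (f : ℕ → ℕ) {xs} ws → xs ⊆ map f ws → Σ (List ℕ) λ vs → vs ⊆ ws × xs ≡ map f vs
⊆-map⁻ f []       []           = [] , [] , refl
⊆-map⁻ f (w ∷ ws) (_ ∷ʳ xs⊆)   with vs , vs⊆ , refl ← ⊆-map⁻ f ws xs⊆ = vs , w ∷ʳ vs⊆ , refl
⊆-map⁻ f (w ∷ ws) (refl ∷ xs⊆) with vs , vs⊆ , refl ← ⊆-map⁻ f ws xs⊆ = w ∷ vs , refl ∷ vs⊆ , refl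

Occurs-⊆ : ∀ p {xs ys} → xs ⊆ ys → Occurs p xs → Occurs p ys
Occurs-⊆ p xs⊆ys (x , y , z , xyz⊆ , shape) = x , y , z , ⊆-trans xyz⊆ xs⊆ys , shape

Occurs-map-+⁺ : ∀ p c {w} → Occurs p w → Occurs p (map (c +_) w)
Occurs-map-+⁺ p c (x , y , z , xyz⊆ , shape) = c + x , c + y , c + z , Sublist.map⁺ (c +_) xyz⊆ , Shape-+⁺ p c shape

Occurs-map-+⁻ : ∀ p c w → Occurs p (map (c +_) w) → Occurs p w
Occurs-map-+⁻ p c w (_ , _ , _ , xyz⊆ , shape) with ⊆-map⁻ (c +_) w xyz⊆
... | x ∷ y ∷ z ∷ [] , xyz⊆w , refl = x , y , z , xyz⊆w , Shape-+⁻ p c shape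

⊆-++⁻ : ∀ {xs} as bs → xs ⊆ as ++ bs →
        Σ (List ℕ) λ xs₁ → Σ (List ℕ) λ xs₂ → xs ≡ xs₁ ++ xs₂ × xs₁ ⊆ as × xs₂ ⊆ bs
⊆-++⁻ []       bs xs⊆ = [] , _ , refl , [] , xs⊆
⊆-++⁻ (a ∷ as) bs (_ ∷ʳ xs⊆) with xs₁ , xs₂ , refl , ⊆as , ⊆bs ← ⊆-++⁻ as bs xs⊆ =
  xs₁ , xs₂ , refl , a ∷ʳ ⊆as , ⊆bs
⊆-++⁻ (a ∷ as) bs (refl ∷ xs⊆) with xs₁ , xs₂ , refl , ⊆as , ⊆bs ← ⊆-++⁻ as bs xs⊆ =
  a ∷ xs₁ , xs₂ , refl , refl ∷ ⊆as , ⊆bs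

data Placement (x y z : ℕ) (as bs : List ℕ) : Set where
  within-left  : (x ∷ y ∷ z ∷ []) ⊆ as → Placement x y z as bs
  across       : x ∈ as → z ∈ bs → Placement x y z as bs
  within-right : (x ∷ y ∷ z ∷ []) ⊆ bs → Placement x y z as bs

placement : ∀ {x y z} as bs → (x ∷ y ∷ z ∷ []) ⊆ as ++ bs → Placement x y z as bs
placement as bs xyz⊆ with ⊆-++⁻ as bs xyz⊆
... | []               , _  , refl , _   , ⊆bs = within-right ⊆bs
... | (_ ∷ [])         , _  , refl , ⊆as , ⊆bs =
  across (Sublist.Any-resp-⊆ ⊆as (here refl)) (Sublist.Any-resp-⊆ ⊆bs (there (here refl)))
... | (_ ∷ _ ∷ [])     , _  , refl , ⊆as , ⊆bs =
  across (Sublist.Any-resp-⊆ ⊆as (here refl)) (Sublist.Any-resp-⊆ ⊆bs (here refl))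
... | (_ ∷ _ ∷ _ ∷ []) , [] , refl , ⊆as , _   = within-left ⊆as

map-+-bounded : ∀ c {n w} → w ↭ range 0 n → All (_≤ c + n) (map (c +_) w)
map-+-bounded c w↭ = All.map⁺ (All.map (λ (_ , u≤n) → +-monoʳ-≤ c u≤n) (↭-range-bounds w↭))

combine : Pattern → List ℕ → List ℕ → List ℕ
combine p213 l r = around1 (suc (length r)) 1 l r
combine p312 l r = around1 1 (suc (length l)) l r

Valid : Pattern → List ℕ → Set
Valid p w = IsPerm (length w) w × Avoids w (letters p) × Jacobi w

IsPerm⇒↭range : ∀ {m w} → IsPerm m w → w ↭ range 0 m
IsPerm⇒↭range {m} {w} = subst (w ↭_) (oneTo≡range m)

↭range⇒IsPerm : ∀ {m w} → w ↭ range 0 m → IsPerm m w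
↭range⇒IsPerm {m} {w} = subst (w ↭_) (sym (oneTo≡range m))

↭range⇒Positive : ∀ {m w} → w ↭ range 0 m → Positive w
↭range⇒Positive w↭ = All.map proj₁ (↭-range-bounds w↭)

Valid⇒Positive : ∀ p {w} → Valid p w → Positive w
Valid⇒Positive p (perm , _) = ↭range⇒Positive (IsPerm⇒↭range perm)

around1-positive : ∀ c d l r → Positive (around1 (suc c) (suc d) l r)
around1-positive c d l r =
  All.++⁺ (All.map⁺ (All.universal (λ _ → s≤s z≤n) l)) (s≤s z≤n ∷ All.map⁺ (All.universal (λ _ → s≤s z≤n) r))

combine-positive : ∀ p l r → Positive (combine p l r)
combine-positive p213 l r = around1-positive _ 0 l r
combine-positive p312 l r = around1-positive 0 _ l r

length-combine : ∀ p l r → length (combine p l r) ≡ length l + suc (length r)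
length-combine p213 l r = length-around1 _ _ l r
length-combine p312 l r = length-around1 _ _ l r

des-combine : ∀ p {l r} → Positive l → Positive r → des (combine p l r) ≡ weight left l + weight right r
des-combine p213 = des-around1 _ 0
des-combine p312 = des-around1 0 _

combine-injective : ∀ p {l l′ r r′} → Positive l → Positive l′ → combine p l r ≡ combine p l′ r′ → l ≡ l′ × r ≡ r′
combine-injective p213 {r = r} l>0 l′>0 eq
  with l-eq , r-eq ← around1-injective _ _ 1 1 l>0 l′>0 eq
  with refl ← map-+-injective 1 r-eq
  = map-+-injective (suc (length r)) l-eq , refl
combine-injective p312 {l = l} l>0 l′>0 eq
  with l-eq , r-eq ← around1-injective 0 0 _ _ l>0 l′>0 eq
  with refl ← map-+-injective 1 l-eq
  = refl , map-+-injective (suc (length l)) r-eq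

combine≢[] : ∀ p l r → combine p l r ≢ []
combine≢[] p213 l r = around1≢[] _ _ l r
combine≢[] p312 l r = around1≢[] _ _ l r

combine-↭ : ∀ p {l r} → l ↭ range 0 (length l) → r ↭ range 0 (length r) →
            combine p l r ↭ range 0 (length l + suc (length r))
combine-↭ p213 {l} {r} l↭ r↭ = ↭-trans (++-comm (map (suc b +_) l) (1 ∷ map (1 +_) r))
  (↭-trans (++⁺ (↭-prep 1 (map-+-↭-range 1 r↭)) (map-+-↭-range (suc b) l↭))
           (↭-reflexive (trans (sym (range-++ 0 (suc b) a)) (cong (range 0) (+-comm (suc b) a)))))
  where
  a b : ℕ
  a = length l
  b = length r
combine-↭ p312 {l} {r} l↭ r↭ = ↭-trans (↭-shift 1 (map (1 +_) l) (map (suc a +_) r))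
  (↭-trans (↭-prep 1 (++⁺ (map-+-↭-range 1 l↭) (map-+-↭-range (suc a) r↭)))
           (↭-reflexive (trans (sym (range-++ 0 (suc a) b)) (cong (range 0) (sym (+-suc a b))))))
  where
  a b : ℕ
  a = length l
  b = length r

-- An occurrence crossing the two blocks contradicts their relative order, and one starting at the
-- letter 1 would need a letter below 1; so it lies within l or within r.
combine-avoids : ∀ p {l r} → l ↭ range 0 (length l) → r ↭ range 0 (length r) →
                 ¬ Occurs p l → ¬ Occurs p r → ¬ Occurs p (combine p l r)
combine-avoids p213 {l} {r} l↭ r↭ ¬l ¬r (x , y , z , xyz⊆ , y<x , x<z)
  with placement (map (suc (length r) +_) l) (1 ∷ map (1 +_) r) xyz⊆
... | within-left xyz⊆l        = ¬l (Occurs-map-+⁻ p213 _ l (x , y , z , xyz⊆l , y<x , x<z))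
... | across x∈l z∈r           =
  <-asym x<z (≤-<-trans (All.lookup (s≤s z≤n ∷ map-+-bounded 1 r↭) z∈r) (All.lookup (map-+-above _ (↭range⇒Positive l↭)) x∈l))
... | within-right (_ ∷ʳ xyz⊆r) = ¬r (Occurs-map-+⁻ p213 1 r (x , y , z , xyz⊆r , y<x , x<z))
... | within-right (refl ∷ _)   with _ ∷ y>0 ∷ _ ← Sublist.All-resp-⊆ xyz⊆ (combine-positive p213 l r) = <⇒≱ y<x y>0
combine-avoids p312 {l} {r} l↭ r↭ ¬l ¬r (x , y , z , xyz⊆ , y<z , z<x)
  with placement (map (1 +_) l) (1 ∷ map (suc (length l) +_) r) xyz⊆
... | within-left xyz⊆l          = ¬l (Occurs-map-+⁻ p312 1 l (x , y , z , xyz⊆l , y<z , z<x))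
... | across _ (here refl)       with _ ∷ y>0 ∷ _ ← Sublist.All-resp-⊆ xyz⊆ (combine-positive p312 l r) = <⇒≱ y<z y>0
... | across x∈l (there z∈r)     =
  <-asym z<x (≤-<-trans (All.lookup (map-+-bounded 1 l↭) x∈l) (All.lookup (map-+-above _ (↭range⇒Positive r↭)) z∈r))
... | within-right (_ ∷ʳ xyz⊆r)  = ¬r (Occurs-map-+⁻ p312 _ r (x , y , z , xyz⊆r , y<z , z<x))
... | within-right (refl ∷ _)    with _ ∷ _ ∷ z>0 ∷ _ ← Sublist.All-resp-⊆ xyz⊆ (combine-positive p312 l r) = <⇒≱ z<x z>0

Avoids⇒¬Occurs : ∀ p {π} → Avoids π (letters p) → ¬ Occurs p π
Avoids⇒¬Occurs p avoids = avoids ∘ Occurs⇒Contains p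

¬Occurs⇒Avoids : ∀ p {π} → ¬ Occurs p π → Avoids π (letters p)
¬Occurs⇒Avoids p ¬occurs = ¬occurs ∘ Contains⇒Occurs p

Jacobi-combine⁺ : ∀ p {l r} → Positive l → Positive r → Jacobi l → Even (length r) → Jacobi r → Jacobi (combine p l r)
Jacobi-combine⁺ p213 = Jacobi-around1⁺ _ 0
Jacobi-combine⁺ p312 = Jacobi-around1⁺ 0 _

Jacobi-combine⁻ : ∀ p {l r} → Positive l → Positive r → Jacobi (combine p l r) → Jacobi l × Even (length r) × Jacobi r
Jacobi-combine⁻ p213 = Jacobi-around1⁻ _ 0
Jacobi-combine⁻ p312 = Jacobi-around1⁻ 0 _

Occurs-combineˡ : ∀ p {l} r → Occurs p l → Occurs p (combine p l r)
Occurs-combineˡ p213 r occ = Occurs-⊆ p213 (Sublist.++⁺ʳ _ ⊆-refl) (Occurs-map-+⁺ p213 _ occ)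
Occurs-combineˡ p312 r occ = Occurs-⊆ p312 (Sublist.++⁺ʳ _ ⊆-refl) (Occurs-map-+⁺ p312 _ occ)

Occurs-combineʳ : ∀ p l {r} → Occurs p r → Occurs p (combine p l r)
Occurs-combineʳ p213 l occ = Occurs-⊆ p213 (Sublist.++⁺ˡ _ (1 ∷ʳ ⊆-refl)) (Occurs-map-+⁺ p213 _ occ)
Occurs-combineʳ p312 l occ = Occurs-⊆ p312 (Sublist.++⁺ˡ _ (1 ∷ʳ ⊆-refl)) (Occurs-map-+⁺ p312 _ occ)

valid-combine⁺ : ∀ p {l r} → Valid p l → Valid p r → Even (length r) → Valid p (combine p l r)
valid-combine⁺ p {l} {r} (l-perm , l-avoids , l-jacobi) (r-perm , r-avoids , r-jacobi) even =
  ↭range⇒IsPerm (subst (λ m → combine p l r ↭ range 0 m) (sym (length-combine p l r)) (combine-↭ p l↭ r↭)) ,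
  ¬Occurs⇒Avoids p (combine-avoids p l↭ r↭ (Avoids⇒¬Occurs p l-avoids) (Avoids⇒¬Occurs p r-avoids)) ,
  Jacobi-combine⁺ p (↭range⇒Positive l↭) (↭range⇒Positive r↭) l-jacobi even r-jacobi
  where
  l↭ : l ↭ range 0 (length l)
  l↭ = IsPerm⇒↭range l-perm
  r↭ : r ↭ range 0 (length r)
  r↭ = IsPerm⇒↭range r-perm

valid-combine⁻ : ∀ p {l r} → l ↭ range 0 (length l) → r ↭ range 0 (length r) → Valid p (combine p l r) →
                 Valid p l × Valid p r × Even (length r)
valid-combine⁻ p {l} {r} l↭ r↭ (_ , avoids , jacobi)
  with l-jacobi , even , r-jacobi ← Jacobi-combine⁻ p (↭range⇒Positive l↭) (↭range⇒Positive r↭) jacobi =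
  (↭range⇒IsPerm l↭ , ¬Occurs⇒Avoids p (Avoids⇒¬Occurs p avoids ∘ Occurs-combineˡ p r) , l-jacobi) ,
  (↭range⇒IsPerm r↭ , ¬Occurs⇒Avoids p (Avoids⇒¬Occurs p avoids ∘ Occurs-combineʳ p l) , r-jacobi) ,
  even

-- Decomposition at the letter 1

Combination : Pattern → List ℕ → Set
Combination p π = Σ (List ℕ) λ l → Σ (List ℕ) λ r →
                  π ≡ combine p l r × l ↭ range 0 (length l) × r ↭ range 0 (length r)

Unique-++-disjoint : ∀ (xs : List ℕ) {ys x y} → Unique (xs ++ ys) → x ∈ xs → y ∈ ys → x ≢ y
Unique-++-disjoint (x ∷ xs) (x≢ ∷ _) (here refl) y∈ys = All.lookup (All.++⁻ʳ xs x≢) y∈ys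
Unique-++-disjoint (_ ∷ xs) (_ ∷ u)  (there x∈) y∈ys = Unique-++-disjoint xs u x∈ y∈ys

Unique-++⁻ʳ : ∀ (xs : List ℕ) {ys} → Unique (xs ++ ys) → Unique ys
Unique-++⁻ʳ []       u       = u
Unique-++⁻ʳ (_ ∷ xs) (_ ∷ u) = Unique-++⁻ʳ xs u

record SplitAt1 (π : List ℕ) : Set where
  field
    α β      : List ℕ
    π≡       : π ≡ α ++ 1 ∷ β
    α>1      : All (1 <_) α
    β>1      : All (1 <_) β
    distinct : ∀ {u v} → u ∈ α → v ∈ β → u ≢ v

splitAt1 : ∀ {m π} → π ↭ range 0 (suc m) → SplitAt1 π
splitAt1 {m} π↭ with α , β , refl ← ∈-∃++ (∈-resp-↭ (↭-sym π↭) (here refl)) = record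
  { α = α ; β = β ; π≡ = refl
  ; α>1 = All.tabulate λ u∈α →
      ≤∧≢⇒< (proj₁ (All.lookup α-bounds u∈α)) (≢-sym (Unique-++-disjoint α unique u∈α (here refl)))
  ; β>1 = All.zipWith (λ ((u>0 , _) , 1≢u) → ≤∧≢⇒< u>0 1≢u) (β-bounds , 1≢β)
  ; distinct = λ u∈α v∈β → Unique-++-disjoint α unique u∈α (there v∈β)
  }
  where
  unique : Unique (α ++ 1 ∷ β)
  unique = ↭-range-unique π↭
  α-bounds : All (λ x → 0 < x × x ≤ suc m) α
  α-bounds = All.++⁻ˡ α (↭-range-bounds π↭)
  β-bounds : All (λ x → 0 < x × x ≤ suc m) β
  β-bounds = All.tail (All.++⁻ʳ α (↭-range-bounds π↭))
  1≢β : All (1 ≢_) β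
  1≢β = AllPairs.head (Unique-++⁻ʳ α unique)

module _ {π : List ℕ} (s : SplitAt1 π) where
  open SplitAt1 s

  letter-1-between : ∀ {u v} → u ∈ α → v ∈ β → (u ∷ 1 ∷ v ∷ []) ⊆ π
  letter-1-between u∈α v∈β = subst ((_ ∷ 1 ∷ _ ∷ []) ⊆_) (sym π≡) (Sublist.++⁺ (from∈ u∈α) (refl ∷ from∈ v∈β))

  separated-213 : ¬ Occurs p213 π → ∀ {u v} → u ∈ α → v ∈ β → v < u
  separated-213 ¬occ {u} {v} u∈α v∈β =
    ≤∧≢⇒< (≮⇒≥ λ u<v → ¬occ (u , 1 , v , letter-1-between u∈α v∈β , All.lookup α>1 u∈α , u<v))
          (≢-sym (distinct u∈α v∈β))

  separated-312 : ¬ Occurs p312 π → ∀ {u v} → u ∈ α → v ∈ β → u < v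
  separated-312 ¬occ {u} {v} u∈α v∈β =
    ≤∧≢⇒< (≮⇒≥ λ v<u → ¬occ (u , 1 , v , letter-1-between u∈α v∈β , All.lookup β>1 v∈β , v<u))
          (distinct u∈α v∈β)

  blocks-213 : ∀ {m} → π ↭ range 0 m → ¬ Occurs p213 π →
               (1 ∷ β ↭ range 0 (suc (length β))) × (α ↭ range (suc (length β)) (length α))
  blocks-213 π↭ ¬occ = ↭-range-blocks (1 ∷ β) α (↭-trans (++-comm (1 ∷ β) α) (subst (_↭ _) π≡ π↭)) below
    where
    below : ∀ {w u} → w ∈ 1 ∷ β → u ∈ α → w < u
    below (here refl) u∈α = All.lookup α>1 u∈α
    below (there v∈β) u∈α = separated-213 ¬occ u∈α v∈β

  blocks-312 : ∀ {m} → π ↭ range 0 m → ¬ Occurs p312 π →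
               (α ++ [ 1 ] ↭ range 0 (length (α ++ [ 1 ]))) × (β ↭ range (length (α ++ [ 1 ])) (length β))
  blocks-312 π↭ ¬occ =
    ↭-range-blocks (α ++ [ 1 ]) β (↭-trans (↭-reflexive (++-assoc α [ 1 ] β)) (subst (_↭ _) π≡ π↭)) below
    where
    below : ∀ {w v} → w ∈ α ++ [ 1 ] → v ∈ β → w < v
    below w∈ v∈β with ∈-++⁻ α w∈
    ... | inj₁ w∈α        = separated-312 ¬occ w∈α v∈β
    ... | inj₂ (here refl) = All.lookup β>1 v∈β

  combine-213 : Shifted (suc (length β)) α → Shifted 1 β → Combination p213 π
  combine-213 (l , α≡ , l↭) (r , β≡ , r↭) =
    l , r , trans π≡ (cong₂ (λ a b → a ++ 1 ∷ b) (trans α≡ (cong (λ n → map (suc n +_) l) |β|≡|r|)) β≡) , l↭ , r↭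
    where
    |β|≡|r| : length β ≡ length r
    |β|≡|r| = trans (cong length β≡) (length-map (1 +_) r)

  combine-312 : Shifted 1 α → Shifted (suc (length α)) β → Combination p312 π
  combine-312 (l , α≡ , l↭) (r , β≡ , r↭) =
    l , r , trans π≡ (cong₂ (λ a b → a ++ 1 ∷ b) α≡ (trans β≡ (cong (λ n → map (suc n +_) r) |α|≡|l|))) , l↭ , r↭
    where
    |α|≡|l| : length α ≡ length l
    |α|≡|l| = trans (cong length α≡) (length-map (1 +_) l)

  split-213 : ∀ {m} → π ↭ range 0 m → ¬ Occurs p213 π → Combination p213 π
  split-213 π↭ ¬occ = combine-213 (↭-range-unshift _ upper) (↭-range-unshift 1 (drop-∷ lower))
    where
    lower : 1 ∷ β ↭ range 0 (suc (length β))
    lower = proj₁ (blocks-213 π↭ ¬occ)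
    upper : α ↭ range (suc (length β)) (length α)
    upper = proj₂ (blocks-213 π↭ ¬occ)

  split-312 : ∀ {m} → π ↭ range 0 m → ¬ Occurs p312 π → Combination p312 π
  split-312 π↭ ¬occ = combine-312 (↭-range-unshift 1 (drop-∷ (↭-trans (++-comm [ 1 ] α) lower))) (↭-range-unshift _ upper)
    where
    |α1|≡ : length (α ++ [ 1 ]) ≡ suc (length α)
    |α1|≡ = trans (length-++ α) (+-comm (length α) 1)
    lower : α ++ [ 1 ] ↭ range 0 (suc (length α))
    lower = subst (λ n → α ++ [ 1 ] ↭ range 0 n) |α1|≡ (proj₁ (blocks-312 π↭ ¬occ))
    upper : β ↭ range (suc (length α)) (length β)
    upper = subst (λ n → β ↭ range n (length β)) |α1|≡ (proj₂ (blocks-312 π↭ ¬occ))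

split-combine : ∀ p {m π} → π ↭ range 0 (suc m) → ¬ Occurs p π → Combination p π
split-combine p213 π↭ = split-213 (splitAt1 π↭) π↭
split-combine p312 π↭ = split-312 (splitAt1 π↭) π↭

decompose : ∀ p {x w} → Valid p (x ∷ w) →
            Σ (List ℕ) λ l → Σ (List ℕ) λ r → x ∷ w ≡ combine p l r × Valid p l × Valid p r × Even (length r)
decompose p valid@(perm , avoids , _)
  with l , r , π≡ , l↭ , r↭ ← split-combine p (IsPerm⇒↭range perm) (Avoids⇒¬Occurs p avoids)
  = l , r , π≡ , valid-combine⁻ p l↭ r↭ (subst (Valid p) π≡ valid)

Valid-[] : ∀ p → Valid p []
Valid-[] p = ↭-refl , ¬Occurs⇒Avoids p (λ { (_ , _ , _ , () , _) }) , _

-- Forests of even words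

Even-suc-suc⁻ : ∀ {n} → Even (suc (suc n)) → Even n
Even-suc-suc⁻ {n} (suc h , eq) = h , suc-injective (trans (suc-injective eq) (+-suc h h))

¬Even-suc : ∀ {n} → Even n → ¬ Even (suc n)
¬Even-suc {zero}        _    (zero  , ())
¬Even-suc {zero}        _    (suc h , eq) = contradiction (trans (suc-injective eq) (+-suc h h)) λ ()
¬Even-suc {suc zero}    even _ = ¬Even-suc {zero} (0 , refl) even
¬Even-suc {suc (suc n)} even even′ = ¬Even-suc (Even-suc-suc⁻ even) (Even-suc-suc⁻ even′)

Even-suc-suc⁺ : ∀ {n} → Even n → Even (suc (suc n))
Even-suc-suc⁺ (h , refl) = suc h , cong suc (sym (+-suc h h))

Even-+ : ∀ {m n} → Even m → Even n → Even (m + n)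
Even-+ (h , refl) (g , refl) = h + g , regroup h g
  where
  regroup : ∀ h g → h + h + (g + g) ≡ h + g + (h + g)
  regroup = solve-∀

Even-+-cancelʳ : ∀ m {n} → Even (m + n) → Even n → Even m
Even-+-cancelʳ m even (zero  , refl) = subst Even (+-identityʳ m) even
Even-+-cancelʳ m even (suc g , refl) =
  Even-+-cancelʳ m (Even-suc-suc⁻ (subst Even (regroup m g) even)) (g , refl)
  where
  regroup : ∀ m g → m + (suc g + suc g) ≡ suc (suc (m + (g + g)))
  regroup = solve-∀

extra : Slot → ℕ
extra left  = 2
extra right = 1

weight-left-nonempty : ∀ {w} → w ≢ [] → weight left w ≡ suc (des w)
weight-left-nonempty {[]}    w≢[] = contradiction refl w≢[]
weight-left-nonempty {_ ∷ _} _    = refl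

double-suc-suc⁻ : ∀ {n t} → double n ≡ suc (suc t) → Σ ℕ λ n′ → n ≡ suc n′ × double n′ ≡ t
double-suc-suc⁻ {suc n} eq = n , refl , suc-injective (suc-injective eq)

totalLength : ∀ {m} → Vec (List ℕ) m → ℕ
totalLength []       = 0
totalLength (w ∷ ws) = length w + totalLength ws

totalWeight : (sl : List Slot) → Vec (List ℕ) (length sl) → ℕ
totalWeight []       []       = 0
totalWeight (s ∷ sl) (w ∷ ws) = weight s w + totalWeight sl ws

Unique-map⁺-on : ∀ {A B : Set} (f : A → B) {xs} → (∀ {x y} → x ∈ xs → y ∈ xs → f x ≡ f y → x ≡ y) →
                 Unique xs → Unique (map f xs)
Unique-map⁺-on f             inj []         = []
Unique-map⁺-on f {xs = x ∷ xs} inj (x∉ ∷ u) =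
  All.map⁺ (All.tabulate λ y∈ fx≡fy → All.lookup x∉ y∈ (inj (here refl) (there y∈) fx≡fy)) ∷
  Unique-map⁺-on f (λ x∈ y∈ → inj (there x∈) (there y∈)) u

module _ (p : Pattern) where

  EvenValid : List ℕ → Set
  EvenValid w = Valid p w × Even (length w)

  record IsForest (n : ℕ) (sl : List Slot) (k : ℕ) (ws : Vec (List ℕ) (length sl)) : Set where
    field
      valid   : VecAll.All EvenValid ws
      length≡ : totalLength ws ≡ double n
      weight≡ : totalWeight sl ws ≡ k

  node : ∀ {m} → Vec (List ℕ) (3 + m) → Vec (List ℕ) (suc m)
  node (b ∷ a₁ ∷ a₂ ∷ ws) = combine p (combine p b a₁) a₂ ∷ ws

  length-node : ∀ b a₁ a₂ → length (combine p (combine p b a₁) a₂) ≡ suc (suc (length b + (length a₁ + length a₂)))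
  length-node b a₁ a₂ rewrite length-combine p (combine p b a₁) a₂ | length-combine p b a₁ =
    regroup (length b) (length a₁) (length a₂)
    where
    regroup : ∀ x y z → x + suc y + suc z ≡ suc (suc (x + (y + z)))
    regroup = solve-∀

  des-node : ∀ {b a₁ a₂} → Positive b → Positive a₁ → Positive a₂ →
             des (combine p (combine p b a₁) a₂) ≡ suc (weight left b + (weight right a₁ + weight right a₂))
  des-node {b} {a₁} {a₂} b>0 a₁>0 a₂>0 = begin
    des (combine p (combine p b a₁) a₂)                      ≡⟨ des-combine p (combine-positive p b a₁) a₂>0 ⟩
    weight left (combine p b a₁) + weight right a₂           ≡⟨ cong (_+ weight right a₂) (weight-left-nonempty (combine≢[] p b a₁)) ⟩
    suc (des (combine p b a₁)) + weight right a₂             ≡⟨ cong (λ x → suc x + weight right a₂) (des-combine p b>0 a₁>0) ⟩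
    suc (weight left b + weight right a₁ + weight right a₂)  ≡⟨ cong suc (+-assoc (weight left b) _ _) ⟩
    suc (weight left b + (weight right a₁ + weight right a₂)) ∎
    where open ≡-Reasoning

  weight-node : ∀ s {b a₁ a₂} → Positive b → Positive a₁ → Positive a₂ →
                weight s (combine p (combine p b a₁) a₂) ≡ extra s + (weight left b + (weight right a₁ + weight right a₂))
  weight-node left  {b} {a₁} {a₂} b>0 a₁>0 a₂>0 =
    trans (weight-left-nonempty (combine≢[] p (combine p b a₁) a₂)) (cong suc (des-node b>0 a₁>0 a₂>0))
  weight-node right b>0 a₁>0 a₂>0 = des-node b>0 a₁>0 a₂>0

  EvenValid⇒Positive : ∀ {w} → EvenValid w → Positive w
  EvenValid⇒Positive (valid , _) = Valid⇒Positive p valid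

  split-even : ∀ {x w} → EvenValid (x ∷ w) →
               Σ (List ℕ) λ b → Σ (List ℕ) λ a₁ → Σ (List ℕ) λ a₂ →
               x ∷ w ≡ combine p (combine p b a₁) a₂ × EvenValid b × EvenValid a₁ × EvenValid a₂
  split-even {x} {w} (valid , even) with decompose p valid
  ... | [] , a₂ , eq , _ , _ , even₂ =
    contradiction (subst Even (trans (cong length eq) (length-combine p [] a₂)) even) (¬Even-suc even₂)
  ... | y ∷ l , a₂ , eq , valid-l , valid₂ , even₂
    with b , a₁ , eq′ , valid-b , valid₁ , even₁ ← decompose p valid-l
    = b , a₁ , a₂ , eq″ , (valid-b , even-b) , (valid₁ , even₁) , (valid₂ , even₂)
    where
    eq″ : x ∷ w ≡ combine p (combine p b a₁) a₂
    eq″ = trans eq (cong (λ u → combine p u a₂) eq′)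
    even-b : Even (length b)
    even-b = Even-+-cancelʳ (length b)
      (Even-suc-suc⁻ (subst Even (trans (cong length eq″) (length-node b a₁ a₂)) even))
      (Even-+ even₁ even₂)

  totalLength-node : ∀ {m} (vs : Vec (List ℕ) (3 + m)) → totalLength (node vs) ≡ suc (suc (totalLength vs))
  totalLength-node (b ∷ a₁ ∷ a₂ ∷ ws) =
    trans (cong (_+ totalLength ws) (length-node b a₁ a₂)) (regroup (length b) (length a₁) (length a₂) (totalLength ws))
    where
    regroup : ∀ x y z t → suc (suc (x + (y + z))) + t ≡ suc (suc (x + (y + (z + t))))
    regroup = solve-∀

  totalWeight-node : ∀ s {sl} {vs : Vec (List ℕ) (3 + length sl)} → VecAll.All EvenValid vs →
                     totalWeight (s ∷ sl) (node vs) ≡ extra s + totalWeight (nodeSlots sl) vs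
  totalWeight-node s {sl} {b ∷ a₁ ∷ a₂ ∷ ws} (vb ∷ v₁ ∷ v₂ ∷ _) =
    trans (cong (_+ totalWeight sl ws) (weight-node s (EvenValid⇒Positive vb) (EvenValid⇒Positive v₁) (EvenValid⇒Positive v₂)))
          (regroup (extra s) (weight left b) (weight right a₁) (weight right a₂) (totalWeight sl ws))
    where
    regroup : ∀ e x y z w → e + (x + (y + z)) + w ≡ e + (x + (y + (z + w)))
    regroup = solve-∀

  IsForest-node : ∀ s {n sl k vs} → IsForest n (nodeSlots sl) k vs →
                  IsForest (suc n) (s ∷ sl) (extra s + k) (node vs)
  IsForest-node s {sl = sl} {vs = b ∷ a₁ ∷ a₂ ∷ ws}
                record { valid = valid@(vb ∷ v₁ ∷ v₂ ∷ valid-ws) ; length≡ = length≡ ; weight≡ = weight≡ } = record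
    { valid   = (valid-combine⁺ p (valid-combine⁺ p (proj₁ vb) (proj₁ v₁) (proj₂ v₁)) (proj₁ v₂) (proj₂ v₂) , even)
                ∷ valid-ws
    ; length≡ = trans (totalLength-node (b ∷ a₁ ∷ a₂ ∷ ws)) (cong (λ t → suc (suc t)) length≡)
    ; weight≡ = trans (totalWeight-node s {sl} valid) (cong (extra s +_) weight≡)
    }
    where
    even : Even (length (combine p (combine p b a₁) a₂))
    even = subst Even (sym (length-node b a₁ a₂)) (Even-suc-suc⁺ (Even-+ (proj₂ vb) (Even-+ (proj₂ v₁) (proj₂ v₂))))

  IsForest-unnode : ∀ s {n sl k x w ws} → IsForest n (s ∷ sl) k ((x ∷ w) ∷ ws) →
                    Σ ℕ λ n′ → Σ ℕ λ k′ → Σ (Vec (List ℕ) (3 + length sl)) λ vs →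
                    n ≡ suc n′ × k ≡ extra s + k′ × node vs ≡ (x ∷ w) ∷ ws × IsForest n′ (nodeSlots sl) k′ vs
  IsForest-unnode s {sl = sl} {ws = ws} record { valid = v ∷ valid ; length≡ = length≡ ; weight≡ = weight≡ }
    with b , a₁ , a₂ , eq , vb , v₁ , v₂ ← split-even v
    with node≡ ← cong (_∷ ws) (sym eq)
    with n′ , n≡ , length≡′ ← double-suc-suc⁻ (trans (sym length≡)
                                (trans (cong totalLength (sym node≡)) (totalLength-node (b ∷ a₁ ∷ a₂ ∷ ws))))
    = n′ , _ , b ∷ a₁ ∷ a₂ ∷ ws , n≡ ,
      trans (sym weight≡) (trans (cong (totalWeight (s ∷ sl)) (sym node≡)) (totalWeight-node s {sl} (vb ∷ v₁ ∷ v₂ ∷ valid))) ,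
      node≡ ,
      record { valid = vb ∷ v₁ ∷ v₂ ∷ valid ; length≡ = sym length≡′ ; weight≡ = refl }

  -- The first word of a forest is empty or, by split-even, the node of three even words.
  forests : ℕ → (sl : List Slot) → ℕ → List (Vec (List ℕ) (length sl))
  nodeForests   : ℕ → (s : Slot) (sl : List Slot) → ℕ → List (Vec (List ℕ) (suc (length sl)))

  forests n       (s ∷ sl) k       = map ([] ∷_) (forests n sl k) ++ nodeForests n s sl k
  forests zero    []       zero    = [] ∷ []
  forests zero    []       (suc k) = []
  forests (suc n) []       k       = []

  nodeForests (suc n) right sl (suc k)       = map node (forests n (nodeSlots sl) k)
  nodeForests (suc n) left  sl (suc (suc k)) = map node (forests n (nodeSlots sl) k)
  nodeForests _       _     _  _             = []

  length-forests : ∀ n sl k → length (forests n sl k) ≡ forestCount n sl k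
  length-nodeForests   : ∀ n s sl k → length (nodeForests n s sl k) ≡ nodeCount n s sl k

  length-forests n       (s ∷ sl) k       =
    trans (length-++ (map ([] ∷_) (forests n sl k)))
          (cong₂ _+_ (trans (length-map ([] ∷_) (forests n sl k)) (length-forests n sl k)) (length-nodeForests n s sl k))
  length-forests zero    []       zero    = refl
  length-forests zero    []       (suc k) = refl
  length-forests (suc n) []       k       = refl

  length-nodeForests zero    s     sl k             = refl
  length-nodeForests (suc n) right sl zero          = refl
  length-nodeForests (suc n) right sl (suc k)       =
    trans (length-map node (forests n (nodeSlots sl) k)) (length-forests n (nodeSlots sl) k)
  length-nodeForests (suc n) left  sl zero          = refl
  length-nodeForests (suc n) left  sl (suc zero)    = refl
  length-nodeForests (suc n) left  sl (suc (suc k)) =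
    trans (length-map node (forests n (nodeSlots sl) k)) (length-forests n (nodeSlots sl) k)

  IsForest-[]∷ : ∀ s {n sl k ws} → IsForest n sl k ws → IsForest n (s ∷ sl) k ([] ∷ ws)
  IsForest-[]∷ left  record { valid = valid ; length≡ = length≡ ; weight≡ = weight≡ } =
    record { valid = (Valid-[] p , 0 , refl) ∷ valid ; length≡ = length≡ ; weight≡ = weight≡ }
  IsForest-[]∷ right record { valid = valid ; length≡ = length≡ ; weight≡ = weight≡ } =
    record { valid = (Valid-[] p , 0 , refl) ∷ valid ; length≡ = length≡ ; weight≡ = weight≡ }

  IsForest-[]∷⁻ : ∀ s {n sl k ws} → IsForest n (s ∷ sl) k ([] ∷ ws) → IsForest n sl k ws
  IsForest-[]∷⁻ left  record { valid = _ ∷ valid ; length≡ = length≡ ; weight≡ = weight≡ } =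
    record { valid = valid ; length≡ = length≡ ; weight≡ = weight≡ }
  IsForest-[]∷⁻ right record { valid = _ ∷ valid ; length≡ = length≡ ; weight≡ = weight≡ } =
    record { valid = valid ; length≡ = length≡ ; weight≡ = weight≡ }

  forests-sound : ∀ n sl k {ws} → ws ∈ forests n sl k → IsForest n sl k ws
  nodeForests-sound   : ∀ n s sl k {ws} → ws ∈ nodeForests n s sl k → IsForest n (s ∷ sl) k ws

  forests-sound n (s ∷ sl) k ws∈ with ∈-++⁻ (map ([] ∷_) (forests n sl k)) ws∈
  ... | inj₁ ws∈₁ with _ , ws∈ , refl ← ∈-map⁻ ([] ∷_) ws∈₁ = IsForest-[]∷ s (forests-sound n sl k ws∈)
  ... | inj₂ ws∈₂ = nodeForests-sound n s sl k ws∈₂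
  forests-sound zero [] zero (here refl) = record { valid = [] ; length≡ = refl ; weight≡ = refl }

  nodeForests-sound (suc n) right sl (suc k) ws∈ with _ , vs∈ , refl ← ∈-map⁻ node ws∈ =
    IsForest-node right (forests-sound n (nodeSlots sl) k vs∈)
  nodeForests-sound (suc n) left sl (suc (suc k)) ws∈ with _ , vs∈ , refl ← ∈-map⁻ node ws∈ =
    IsForest-node left (forests-sound n (nodeSlots sl) k vs∈)

  node∈nodeForests : ∀ s {n sl k vs} → vs ∈ forests n (nodeSlots sl) k → node vs ∈ nodeForests (suc n) s sl (extra s + k)
  node∈nodeForests left  vs∈ = ∈-map⁺ node vs∈
  node∈nodeForests right vs∈ = ∈-map⁺ node vs∈

  forests-complete : ∀ n sl k {ws} → IsForest n sl k ws → ws ∈ forests n sl k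
  nodeForests-complete : ∀ n s sl k {x w ws} → IsForest n (s ∷ sl) k ((x ∷ w) ∷ ws) →
                         ((x ∷ w) ∷ ws) ∈ nodeForests n s sl k

  forests-complete n       (s ∷ sl) k {[] ∷ ws}      f = ∈-++⁺ˡ (∈-map⁺ ([] ∷_) (forests-complete n sl k (IsForest-[]∷⁻ s f)))
  forests-complete n       (s ∷ sl) k {(_ ∷ _) ∷ ws} f = ∈-++⁺ʳ (map ([] ∷_) (forests n sl k)) (nodeForests-complete n s sl k f)
  forests-complete zero    []       zero    {[]} _ = here refl
  forests-complete zero    []       (suc k) {[]} f with () ← IsForest.weight≡ f
  forests-complete (suc n) []       k       {[]} f with () ← IsForest.length≡ f

  nodeForests-complete n s sl k f with IsForest-unnode s f
  ... | n′ , k′ , vs , refl , refl , node≡ , f′ =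
    subst (_∈ nodeForests (suc n′) s sl (extra s + k′)) node≡
          (node∈nodeForests s (forests-complete n′ (nodeSlots sl) k′ f′))

  node-injective : ∀ {n sl k vs vs′} → IsForest n (nodeSlots sl) k vs → IsForest n (nodeSlots sl) k vs′ →
                   node vs ≡ node vs′ → vs ≡ vs′
  node-injective {vs = b ∷ a₁ ∷ a₂ ∷ ws} {b′ ∷ a₁′ ∷ a₂′ ∷ ws′}
                 record { valid = vb ∷ v₁ ∷ _ } record { valid = vb′ ∷ v₁′ ∷ _ } eq
    with combine-eq , refl ← combine-injective p (combine-positive p b a₁) (combine-positive p b′ a₁′) (Vec.∷-injectiveˡ eq)
    with refl , refl ← combine-injective p (EvenValid⇒Positive vb) (EvenValid⇒Positive vb′) combine-eq
    = cong (λ ws → b ∷ a₁ ∷ a₂ ∷ ws) (Vec.∷-injectiveʳ eq)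

  nodeForests-first-nonempty : ∀ n s sl k {w ws} → (w ∷ ws) ∈ nodeForests n s sl k → w ≢ []
  nodeForests-first-nonempty (suc n) right sl (suc k) ws∈ with (b ∷ a₁ ∷ a₂ ∷ _) , _ , refl ← ∈-map⁻ node ws∈ =
    combine≢[] p (combine p b a₁) a₂
  nodeForests-first-nonempty (suc n) left sl (suc (suc k)) ws∈ with (b ∷ a₁ ∷ a₂ ∷ _) , _ , refl ← ∈-map⁻ node ws∈ =
    combine≢[] p (combine p b a₁) a₂

  forests-unique : ∀ n sl k → Unique (forests n sl k)
  nodeForests-unique   : ∀ n s sl k → Unique (nodeForests n s sl k)

  forests-unique n (s ∷ sl) k =
    Unique.++⁺ (Unique.map⁺ Vec.∷-injectiveʳ (forests-unique n sl k)) (nodeForests-unique n s sl k) disjoint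
    where
    disjoint : Disjoint (map ([] ∷_) (forests n sl k)) (nodeForests n s sl k)
    disjoint (ws∈₁ , ws∈₂) with _ , _ , refl ← ∈-map⁻ ([] ∷_) ws∈₁ = nodeForests-first-nonempty n s sl k ws∈₂ refl
  forests-unique zero    [] zero    = [] ∷ []
  forests-unique zero    [] (suc k) = []
  forests-unique (suc n) [] k       = []

  nodeForests-unique (suc n) right sl (suc k) =
    Unique-map⁺-on node (λ vs∈ vs′∈ → node-injective (forests-sound n _ k vs∈) (forests-sound n _ k vs′∈)) (forests-unique n _ k)
  nodeForests-unique (suc n) left sl (suc (suc k)) =
    Unique-map⁺-on node (λ vs∈ vs′∈ → node-injective (forests-sound n _ k vs∈) (forests-sound n _ k vs′∈)) (forests-unique n _ k)
  nodeForests-unique zero    s     sl k          = []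
  nodeForests-unique (suc n) right sl zero       = []
  nodeForests-unique (suc n) left  sl zero       = []
  nodeForests-unique (suc n) left  sl (suc zero) = []

  Valid⇒JDes : ∀ {π m k} → Valid p π → length π ≡ m → des π ≡ k → JDes (letters p) m k π
  Valid⇒JDes (perm , avoids , jacobi) refl des≡ = perm , avoids , jacobi , des≡

  JDes⇒Valid : ∀ {π m k} → JDes (letters p) m k π → Valid p π × length π ≡ m
  JDes⇒Valid {π} {m} (perm , avoids , jacobi , _) = (subst (λ m → IsPerm m π) (sym |π|≡) perm , avoids , jacobi) , |π|≡
    where
    |π|≡ : length π ≡ m
    |π|≡ = ↭-range-length (IsPerm⇒↭range perm)

  evenWords : ℕ → ℕ → List (List ℕ)
  evenWords n k = map head (forests (suc n) (right ∷ []) k)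

  length-evenWords : ∀ n k → length (evenWords n k) ≡ forestCount (suc n) (right ∷ []) k
  length-evenWords n k = trans (length-map head (forests (suc n) (right ∷ []) k)) (length-forests (suc n) (right ∷ []) k)

  evenWords-unique : ∀ n k → Unique (evenWords n k)
  evenWords-unique n k = Unique.map⁺ head-injective (forests-unique (suc n) (right ∷ []) k)
    where
    head-injective : ∀ {u v : Vec (List ℕ) 1} → head u ≡ head v → u ≡ v
    head-injective {_ ∷ []} {_ ∷ []} refl = refl

  evenWords-sound : ∀ n k {π} → π ∈ evenWords n k → JDes (letters p) (2 * suc n) k π
  evenWords-sound n k π∈
    with (π ∷ []) , ws∈ , refl ← ∈-map⁻ head π∈
    with record { valid = (valid , _) ∷ [] ; length≡ = length≡ ; weight≡ = weight≡ } ← forests-sound (suc n) (right ∷ []) k ws∈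
    = Valid⇒JDes valid (trans (sym (+-identityʳ _)) (trans length≡ (double≡2* (suc n)))) (trans (sym (+-identityʳ _)) weight≡)

  evenWords-complete : ∀ n k {π} → JDes (letters p) (2 * suc n) k π → π ∈ evenWords n k
  evenWords-complete n k jdes@(_ , _ , _ , des≡) with valid , |π|≡ ← JDes⇒Valid jdes =
    ∈-map⁺ head (forests-complete (suc n) (right ∷ []) k record
      { valid   = (valid , suc n , trans |π|≡ (cong (suc n +_) (+-identityʳ (suc n)))) ∷ []
      ; length≡ = trans (+-identityʳ _) (trans |π|≡ (sym (double≡2* (suc n))))
      ; weight≡ = trans (+-identityʳ _) des≡
      })

  combinePair : Vec (List ℕ) 2 → List ℕ
  combinePair (b ∷ a ∷ []) = combine p b a

  oddWords : ℕ → ℕ → List (List ℕ)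
  oddWords n k = map combinePair (forests n (left ∷ right ∷ []) k)

  length-oddWords : ∀ n k → length (oddWords n k) ≡ forestCount n (left ∷ right ∷ []) k
  length-oddWords n k = trans (length-map combinePair (forests n (left ∷ right ∷ []) k)) (length-forests n (left ∷ right ∷ []) k)

  oddWords-unique : ∀ n k → Unique (oddWords n k)
  oddWords-unique n k = Unique-map⁺-on combinePair pair-injective (forests-unique n (left ∷ right ∷ []) k)
    where
    pair-injective : ∀ {u v} → u ∈ forests n (left ∷ right ∷ []) k → v ∈ forests n (left ∷ right ∷ []) k →
                     combinePair u ≡ combinePair v → u ≡ v
    pair-injective {b ∷ a ∷ []} {b′ ∷ a′ ∷ []} u∈ v∈ eq
      with record { valid = vb ∷ _ } ← forests-sound n _ k u∈
      with record { valid = vb′ ∷ _ } ← forests-sound n _ k v∈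
      with refl , refl ← combine-injective p (EvenValid⇒Positive vb) (EvenValid⇒Positive vb′) eq
      = refl

  oddWords-sound : ∀ n k {π} → π ∈ oddWords n k → JDes (letters p) (suc (2 * n)) k π
  oddWords-sound n k π∈
    with (b ∷ a ∷ []) , ws∈ , refl ← ∈-map⁻ combinePair π∈
    with record { valid = (vb , _) ∷ (va , even-a) ∷ [] ; length≡ = length≡ ; weight≡ = weight≡ } ← forests-sound n _ k ws∈
    = Valid⇒JDes (valid-combine⁺ p vb va even-a) |ba|≡
        (trans (des-combine p (Valid⇒Positive p vb) (Valid⇒Positive p va))
               (trans (cong (weight left b +_) (sym (+-identityʳ _))) weight≡))
    where
    |ba|≡ : length (combine p b a) ≡ suc (2 * n)
    |ba|≡ = begin
      length (combine p b a)          ≡⟨ length-combine p b a ⟩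
      length b + suc (length a)       ≡⟨ +-suc (length b) (length a) ⟩
      suc (length b + length a)       ≡⟨ cong (λ t → suc (length b + t)) (sym (+-identityʳ (length a))) ⟩
      suc (length b + (length a + 0)) ≡⟨ cong suc (trans length≡ (double≡2* n)) ⟩
      suc (2 * n)                     ∎
      where open ≡-Reasoning

  oddWords-complete : ∀ n k {π} → JDes (letters p) (suc (2 * n)) k π → π ∈ oddWords n k
  oddWords-complete n k {[]}    jdes with () ← proj₂ (JDes⇒Valid jdes)
  oddWords-complete n k {x ∷ w} jdes@(_ , _ , _ , des≡)
    with valid , |π|≡ ← JDes⇒Valid jdes
    with b , a , π≡ , vb , va , even-a ← decompose p valid
    = subst (_∈ oddWords n k) (sym π≡) (∈-map⁺ combinePair (forests-complete n (left ∷ right ∷ []) k record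
      { valid   = (vb , even-b) ∷ (va , even-a) ∷ []
      ; length≡ = trans (cong (length b +_) (+-identityʳ (length a))) (trans |b|+|a|≡ (sym (double≡2* n)))
      ; weight≡ = trans (cong (weight left b +_) (+-identityʳ _))
                        (trans (sym (des-combine p (Valid⇒Positive p vb) (Valid⇒Positive p va)))
                               (trans (cong des (sym π≡)) des≡))
      }))
    where
    |b|+|a|≡ : length b + length a ≡ 2 * n
    |b|+|a|≡ = suc-injective (trans (sym (+-suc (length b) (length a)))
                                    (trans (sym (length-combine p b a)) (trans (cong length (sym π≡)) |π|≡)))
    even-b : Even (length b)
    even-b = Even-+-cancelʳ (length b) (n , trans |b|+|a|≡ (cong (n +_) (+-identityʳ n))) even-a

evenCase : ∀ p (n k : ℕ) → Σ (List (List ℕ)) λ L → Enumerates (JDes (letters p) (2 * suc n) k) L ×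
           suc n * length L ≡ binomZ (suc n) k (suc n) * ((2 * suc n) C (suc k))
evenCase p n k =
  evenWords p n k ,
  (evenWords-unique p n k , λ _ → mk⇔ (evenWords-sound p n k) (evenWords-complete p n k)) ,
  trans (cong (suc n *_) (length-evenWords p n k)) (evenCount n k)

oddCase : ∀ p (n k : ℕ) → Σ (List (List ℕ)) λ L → Enumerates (JDes (letters p) (suc (2 * n)) k) L ×
          suc n * length L ≡ binomZ (suc n) k n * ((2 * n) C k)
oddCase p n k =
  oddWords p n k ,
  (oddWords-unique p n k , λ _ → mk⇔ (oddWords-sound p n k) (oddWords-complete p n k)) ,
  trans (cong (suc n *_) (length-oddWords p n k)) (oddCount n k)

theorem4p2 : (σ : List ℕ) → (σ ≡ 2 ∷ 1 ∷ 3 ∷ [] ⊎ σ ≡ 3 ∷ 1 ∷ 2 ∷ []) →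
    ((n k : ℕ) → Σ (List (List ℕ)) λ L → Enumerates (JDes σ (2 * suc n) k) L ×
      suc n * length L ≡ binomZ (suc n) k (suc n) * ((2 * suc n) C (suc k)))
    × ((n k : ℕ) → Σ (List (List ℕ)) λ L → Enumerates (JDes σ (suc (2 * n)) k) L ×
      suc n * length L ≡ binomZ (suc n) k n * ((2 * n) C k))
theorem4p2 σ (inj₁ refl) = evenCase p213 , oddCase p213
theorem4p2 σ (inj₂ refl) = evenCase p312 , oddCase p312
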